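{- Let $m,n$ be nonnegative integers. The graphs $A(m)$ and $A(n)$ are isomorphic as edge-labeled directed graphs if and only if there exists a nonnegative integer $t$ such that $m=2^tn+2^t-1$ or $n=2^tm+2^t-1$.
   Context: Let $\Sigma^*$ be the free monoid of finite words over the alphabet $\{0,1,2\}$ (including the empty word). A word $x_0x_1\cdots x_k\in\Sigma^*$ with $x_0\neq 0$ is a hyperbinary expansion of the nonnegative integer $\sum_{i=0}^k x_i2^{k-i}$; the empty word is the unique hyperbinary expansion of $0$. Let $\mathcal{H}(n)$ be the set of hyperbinary expansions of $n$. The edge-labeled directed graph $A(n)$ has vertex set $\mathcal{H}(n)$; its arcs are all pairs $(u,w)$ of elements of $\mathcal{H}(n)$ of one of the forms: $(\mathbf{x}02\mathbf{y},\mathbf{x}10\mathbf{y})$ or $(2\mathbf{y},10\mathbf{y})$ with $\mathbf{x},\mathbf{y}\in\Sigma^*$, labeled $\to$; or $(\mathbf{x}12\mathbf{y},\mathbf{x}20\mathbf{y})$ with $\mathbf{x},\mathbf{y}\in\Sigma^*$, labeled $\twoheadrightarrow$. An isomorphism of edge-labeled directed graphs is a bijection of vertex sets inducing a bijection of arcs that preserves the labels. -}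

module Defs where

open import Data.Nat using (ℕ; zero; suc; _+_; _*_)
open import Data.List using (List; []; _∷_; _++_)
open import Data.Product using (Σ; ∃; _×_; _,_; proj₁)
open import Data.Sum using (_⊎_)
open import Data.Unit using (⊤)
open import Relation.Binary.PropositionalEquality using (_≡_)

data Digit : Set where
  d0 d1 d2 : Digit

digitVal : Digit → ℕ
digitVal d0 = 0
digitVal d1 = 1
digitVal d2 = 2

-- Σ* : finite words (most significant digit first)
Word : Set
Word = List Digit

valueAcc : ℕ → Word → ℕ
valueAcc acc []      = acc
valueAcc acc (d ∷ w) = valueAcc (2 * acc + digitVal d) w

value : Word → ℕ
value = valueAcc 0

data LeadingNonzero : Word → Set where
  lead-empty : LeadingNonzero []
  lead-one   : ∀ {w} → LeadingNonzero (d1 ∷ w)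
  lead-two   : ∀ {w} → LeadingNonzero (d2 ∷ w)

IsHyperbinary : ℕ → Word → Set
IsHyperbinary n w = LeadingNonzero w × value w ≡ n

H : ℕ → Set
H n = Σ Word (IsHyperbinary n)

data Arrow : Word → Word → Set where
  arr-mid  : ∀ x y → Arrow (x ++ d0 ∷ d2 ∷ y) (x ++ d1 ∷ d0 ∷ y)
  arr-head : ∀ y → Arrow (d2 ∷ y) (d1 ∷ d0 ∷ y)

data DArrow : Word → Word → Set where
  darr : ∀ x y → DArrow (x ++ d1 ∷ d2 ∷ y) (x ++ d2 ∷ d0 ∷ y)

_⇔'_ : Set → Set → Set
P ⇔' Q = (P → Q) × (Q → P)

-- isomorphism of the edge-labelled digraphs A(m) and A(n):
-- a bijection of vertex sets (inverse map given, equality of vertices is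
-- equality of the underlying words) that maps arcs to arcs of the same
-- label and non-arcs to non-arcs (hence induces a label-preserving
-- bijection on arcs).
record Isomorphic (m n : ℕ) : Set where
  field
    to      : H m → H n
    from    : H n → H m
    from∘to : ∀ u → proj₁ (from (to u)) ≡ proj₁ u
    to∘from : ∀ v → proj₁ (to (from v)) ≡ proj₁ v
    arrow   : ∀ u w → Arrow (proj₁ u) (proj₁ w) ⇔' Arrow (proj₁ (to u)) (proj₁ (to w))
    darrow  : ∀ u w → DArrow (proj₁ u) (proj₁ w) ⇔' DArrow (proj₁ (to u)) (proj₁ (to w))

-- The expansions of 2k + 1 are those of k followed by 1, and appending 1 identifies A(k)
-- with A(2k + 1); iterating gives one direction. The converse goes by induction on m + n: the
-- same step removes odd arguments, so let m and n be even and positive.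
-- Every A(n) has a unique source, the zero-free expansion of n, from which every vertex is
-- reachable, each arc lowering the digit sum by one. For even n it reads 1^α 2 R with R of even
-- value, and pushing its first 2 to the front reaches 1 0^(α+1) R; the vertices reachable from
-- there are the words 1 0^k w with w an expansion of value R, a copy of A(value R). For α ≥ 1
-- this vertex has a graph-theoretic description (an anchor) which, in A(n), only vertices X10
-- share. So an isomorphism A(m) ≅ A(n) either matches the two copies, and then R = S by
-- induction and α = β by comparing digit sums, or sends 1 0^(α+1) R to some X10, whose
-- reachable vertices are a copy of A(value X1); then X1 = R 1^t by induction, which determines
-- the zero-free expansion of n, and doing the same in the other direction and counting digit
-- sums shows that the two zero-free expansions coincide.

module Submission where

open import Defs
open import Data.Nat using (ℕ; _+_; _*_; _∸_; _^_)
open import Data.Product using (∃; _×_)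
open import Data.Sum using (_⊎_)
open import Relation.Binary.PropositionalEquality using (_≡_)
open import Data.Nat using (zero; suc; _≤_; _<_; z≤n; s≤s)
open import Data.Nat.Properties
open import Data.Nat.Divisibility using (_∣_; ∣m+n∣m⇒∣n; ∣m∣n⇒∣m+n; ∣n⇒∣m*n; m∣m*n; ∣1⇒≡1)
open import Data.Nat.Induction using (<-rec)
open import Data.Nat.Tactic.RingSolver using (solve-∀)
open import Data.List using (List; []; _∷_; _++_; _∷ʳ_; length; replicate; initLast; _∷ʳ′_)
open import Data.List.Properties
  using (++-assoc; length-++; length-replicate; ∷-injective; ∷-injectiveˡ; ∷-injectiveʳ; ∷ʳ-injective; ++-cancelˡ)
open import Data.List.Reverse using (Reverse; []; _∶_∶ʳ_; reverseView)
open import Data.List.Relation.Unary.All using (All; []; _∷_)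
open import Data.List.Relation.Unary.All.Properties using (++⁺; ++⁻ʳ; ∷ʳ⁺; ∷ʳ⁻; replicate⁺)
open import Data.Product using (Σ; _,_; proj₁; proj₂; ∃-syntax)
open import Data.Sum using (inj₁; inj₂; [_,_]′)
open import Data.Empty using (⊥; ⊥-elim)
open import Function using (id; _∘_)
open import Relation.Binary.Definitions using (tri<; tri≈; tri>)
open import Relation.Binary.PropositionalEquality
  using (_≢_; refl; sym; trans; cong; cong₂; subst; subst₂; module ≡-Reasoning)
open import Relation.Nullary using (¬_)

data NonzeroDigit : Digit → Set where
  nz1 : NonzeroDigit d1
  nz2 : NonzeroDigit d2

ZeroFree : Word → Set
ZeroFree = All NonzeroDigit

ones zeros twos : ℕ → Word
ones k = replicate k d1
zeros k = replicate k d0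
twos k = replicate k d2

nonzero⇒≢d0 : ∀ {d} → NonzeroDigit d → d ≢ d0
nonzero⇒≢d0 nz1 ()
nonzero⇒≢d0 nz2 ()

leading-nonzero : ∀ {d w} → LeadingNonzero (d ∷ w) → NonzeroDigit d
leading-nonzero lead-one = nz1
leading-nonzero lead-two = nz2

nonzero⇒leading : ∀ {d w} → NonzeroDigit d → LeadingNonzero (d ∷ w)
nonzero⇒leading nz1 = lead-one
nonzero⇒leading nz2 = lead-two

zeroFree⇒leading : ∀ {w} → ZeroFree w → LeadingNonzero w
zeroFree⇒leading []        = lead-empty
zeroFree⇒leading (nd ∷ _) = nonzero⇒leading nd

-- Values of words

valueAcc-++ : ∀ a u v → valueAcc a (u ++ v) ≡ valueAcc (valueAcc a u) v
valueAcc-++ a []      v = refl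
valueAcc-++ a (d ∷ u) v = valueAcc-++ (2 * a + digitVal d) u v

valueAcc≡ : ∀ a u → valueAcc a u ≡ a * 2 ^ length u + value u
valueAcc≡ a []      = sym (trans (+-identityʳ _) (*-identityʳ a))
valueAcc≡ a (d ∷ u) = begin
  valueAcc (2 * a + digitVal d) u                                 ≡⟨ valueAcc≡ (2 * a + digitVal d) u ⟩
  (2 * a + digitVal d) * P + value u                              ≡⟨ regroup a (digitVal d) P (value u) ⟩
  a * (2 * P) + (digitVal d * P + value u)
    ≡⟨ cong (a * (2 * P) +_) (sym (valueAcc≡ (digitVal d) u)) ⟩
  a * (2 * P) + value (d ∷ u)                                     ∎
  where
  open ≡-Reasoning
  P : ℕ
  P = 2 ^ length u
  regroup : ∀ a b P v → (2 * a + b) * P + v ≡ a * (2 * P) + (b * P + v)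
  regroup = solve-∀

value-∷ : ∀ d u → value (d ∷ u) ≡ digitVal d * 2 ^ length u + value u
value-∷ d u = valueAcc≡ (digitVal d) u

value-++ : ∀ u v → value (u ++ v) ≡ value u * 2 ^ length v + value v
value-++ u v = trans (valueAcc-++ 0 u v) (valueAcc≡ (value u) v)

value-∷ʳ : ∀ u d → value (u ∷ʳ d) ≡ 2 * value u + digitVal d
value-∷ʳ u d = valueAcc-++ 0 u (d ∷ [])

value-zeros-++ : ∀ k u → value (zeros k ++ u) ≡ value u
value-zeros-++ zero    u = refl
value-zeros-++ (suc k) u = value-zeros-++ k u

value-replace : ∀ x {p q} y → (∀ a → valueAcc a p ≡ valueAcc a q) → value (x ++ p ++ y) ≡ value (x ++ q ++ y)
value-replace x {p} {q} y same = begin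
  value (x ++ p ++ y)                 ≡⟨ valueAcc-++ 0 x (p ++ y) ⟩
  valueAcc (value x) (p ++ y)         ≡⟨ valueAcc-++ (value x) p y ⟩
  valueAcc (valueAcc (value x) p) y   ≡⟨ cong (λ a → valueAcc a y) (same (value x)) ⟩
  valueAcc (valueAcc (value x) q) y   ≡⟨ sym (valueAcc-++ (value x) q y) ⟩
  valueAcc (value x) (q ++ y)         ≡⟨ sym (valueAcc-++ 0 x (q ++ y)) ⟩
  value (x ++ q ++ y)                 ∎
  where open ≡-Reasoning

digitVal≤2 : ∀ d → digitVal d ≤ 2
digitVal≤2 d0 = z≤n
digitVal≤2 d1 = s≤s z≤n
digitVal≤2 d2 = ≤-refl

1≤digitVal : ∀ {d} → NonzeroDigit d → 1 ≤ digitVal d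
1≤digitVal nz1 = ≤-refl
1≤digitVal nz2 = s≤s z≤n

value<2^1+length : ∀ u → value u < 2 ^ suc (length u)
value<2^1+length []      = s≤s z≤n
value<2^1+length (d ∷ u) = begin-strict
  value (d ∷ u)             ≡⟨ value-∷ d u ⟩
  digitVal d * P + value u  <⟨ +-mono-≤-< (*-monoˡ-≤ P (digitVal≤2 d)) (value<2^1+length u) ⟩
  2 * P + 2 * P             ≡⟨ cong (2 * P +_) (sym (+-identityʳ (2 * P))) ⟩
  2 * (2 * P)               ∎
  where
  open ≤-Reasoning
  P : ℕ
  P = 2 ^ length u

2^length≤value-∷ : ∀ {d} u → NonzeroDigit d → 2 ^ length u ≤ value (d ∷ u)
2^length≤value-∷ {d} u nd = begin
  2 ^ length u                   ≡⟨ sym (*-identityˡ _) ⟩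
  1 * 2 ^ length u               ≤⟨ *-monoˡ-≤ _ (1≤digitVal nd) ⟩
  digitVal d * 2 ^ length u      ≤⟨ m≤m+n _ _ ⟩
  digitVal d * 2 ^ length u + value u  ≡⟨ sym (value-∷ d u) ⟩
  value (d ∷ u)                  ∎
  where open ≤-Reasoning

2^m<2^n⇒m<n : ∀ {m n} → 2 ^ m < 2 ^ n → m < n
2^m<2^n⇒m<n lt = ≰⇒> (λ n≤m → <⇒≱ lt (^-monoʳ-≤ 2 n≤m))

value<2^⇒length≤ : ∀ {w k} → LeadingNonzero w → value w < 2 ^ k → length w ≤ k
value<2^⇒length≤ lead-empty      _  = z≤n
value<2^⇒length≤ {d ∷ u} lead lt = 2^m<2^n⇒m<n (≤-<-trans (2^length≤value-∷ u (leading-nonzero lead)) lt)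

2^m+x<2^n : ∀ {m n x} → x < 2 ^ m → m < n → 2 ^ m + x < 2 ^ n
2^m+x<2^n {m} {n} {x} x< m<n = begin-strict
  2 ^ m + x        <⟨ +-monoʳ-< (2 ^ m) x< ⟩
  2 ^ m + 2 ^ m    ≡⟨ cong (2 ^ m +_) (sym (+-identityʳ (2 ^ m))) ⟩
  2 ^ suc m        ≤⟨ ^-monoʳ-≤ 2 m<n ⟩
  2 ^ n            ∎
  where open ≤-Reasoning

2^m+x≡2^n+y⇒m≡n : ∀ {m n x y} → x < 2 ^ m → y < 2 ^ n → 2 ^ m + x ≡ 2 ^ n + y → m ≡ n
2^m+x≡2^n+y⇒m≡n {m} {n} {x} {y} x< y< eq with <-cmp m n
... | tri< m<n _ _ = ⊥-elim (<-irrefl eq (<-≤-trans (2^m+x<2^n x< m<n) (m≤m+n _ y)))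
... | tri≈ _ m≡n _ = m≡n
... | tri> _ _ n<m = ⊥-elim (<-irrefl (sym eq) (<-≤-trans (2^m+x<2^n y< n<m) (m≤m+n _ x)))

2∤2*m+1 : ∀ m → ¬ 2 ∣ 2 * m + 1
2∤2*m+1 m 2∣ with ∣1⇒≡1 (∣m+n∣m⇒∣n 2∣ (m∣m*n m))
... | ()

2∣2*m : ∀ m → 2 ∣ 2 * m
2∣2*m m = m∣m*n m

parity : ∀ n → ∃[ k ] (n ≡ 2 * k ⊎ n ≡ 2 * k + 1)
parity zero = 0 , inj₁ refl
parity (suc n) with parity n
... | k , inj₁ refl = k , inj₂ (+-comm 1 (2 * k))
... | k , inj₂ refl = suc k , inj₁ (double-suc k)
  where
  double-suc : ∀ k → suc (2 * k + 1) ≡ 2 * suc k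
  double-suc = solve-∀

2*m+2≢2*n+1 : ∀ m n → 2 * m + 2 ≢ 2 * n + 1
2*m+2≢2*n+1 m n eq = even≢odd (suc m) n (trans (sym (double+2 m)) (trans eq (+-comm (2 * n) 1)))
  where
  double+2 : ∀ m → 2 * m + 2 ≡ 2 * suc m
  double+2 = solve-∀

2*m+d-injective : ∀ {m n d e} → NonzeroDigit d → NonzeroDigit e →
                  2 * m + digitVal d ≡ 2 * n + digitVal e → d ≡ e × m ≡ n
2*m+d-injective {m} {n} nz1 nz1 eq = refl , *-cancelˡ-≡ m n 2 (+-cancelʳ-≡ 1 _ _ eq)
2*m+d-injective {m} {n} nz1 nz2 eq = ⊥-elim (2*m+2≢2*n+1 n m (sym eq))
2*m+d-injective {m} {n} nz2 nz1 eq = ⊥-elim (2*m+2≢2*n+1 m n eq)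
2*m+d-injective {m} {n} nz2 nz2 eq = refl , *-cancelˡ-≡ m n 2 (+-cancelʳ-≡ 2 _ _ eq)

-- Zero-free expansions

value-∷ʳ-positive : ∀ {u d} → NonzeroDigit d → 0 < value (u ∷ʳ d)
value-∷ʳ-positive {u} {d} nd = subst (0 <_) (sym (value-∷ʳ u d)) (≤-trans (1≤digitVal nd) (m≤n+m _ _))

zeroFree-injective : ∀ {u w} → ZeroFree u → ZeroFree w → value u ≡ value w → u ≡ w
zeroFree-injective {u} {w} = go (reverseView u) (reverseView w)
  where
  go : ∀ {u w} → Reverse u → Reverse w → ZeroFree u → ZeroFree w → value u ≡ value w → u ≡ w
  go [] [] _ _ _ = refl
  go [] (w ∶ _ ∶ʳ e) _ zw eq = ⊥-elim (<⇒≢ (value-∷ʳ-positive {w} (proj₂ (∷ʳ⁻ zw))) eq)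
  go (u ∶ _ ∶ʳ d) [] zu _ eq = ⊥-elim (<⇒≢ (value-∷ʳ-positive {u} (proj₂ (∷ʳ⁻ zu))) (sym eq))
  go (u ∶ ru ∶ʳ d) (w ∶ rw ∶ʳ e) zu zw eq
    with zu′ , nd ← ∷ʳ⁻ zu | zw′ , ne ← ∷ʳ⁻ zw
    with refl , u≡w ← 2*m+d-injective nd ne (trans (sym (value-∷ʳ u d)) (trans eq (value-∷ʳ w e)))
    = cong (_∷ʳ d) (go ru rw zu′ zw′ u≡w)

ZeroFreeExpansion : ℕ → Set
ZeroFreeExpansion n = ∃[ w ] ZeroFree w × value w ≡ n

zeroFree-expansion : ∀ n → ZeroFreeExpansion n
zeroFree-expansion = <-rec ZeroFreeExpansion expand
  where
  append : ∀ {k} d → NonzeroDigit d → ZeroFreeExpansion k → ZeroFreeExpansion (2 * k + digitVal d)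
  append d nd (w , zw , refl) = w ∷ʳ d , ∷ʳ⁺ zw nd , value-∷ʳ w d
  expand : ∀ n → (∀ {m} → m < n → ZeroFreeExpansion m) → ZeroFreeExpansion n
  expand zero    _   = [] , [] , refl
  expand (suc n) rec with parity n
  ... | k , inj₁ refl = subst ZeroFreeExpansion (+-comm (2 * k) 1) (append d1 nz1 (rec {k} (s≤s (m≤m+n k _))))
  ... | k , inj₂ refl = subst ZeroFreeExpansion (+-suc (2 * k) 1)
                              (append d2 nz2 (rec {k} (s≤s (≤-trans (m≤m+n k _) (m≤m+n _ 1)))))

digitSum : Word → ℕ
digitSum []      = 0
digitSum (d ∷ w) = digitVal d + digitSum w

digitSum-++ : ∀ u v → digitSum (u ++ v) ≡ digitSum u + digitSum v
digitSum-++ []      v = refl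
digitSum-++ (d ∷ u) v = trans (cong (digitVal d +_) (digitSum-++ u v)) (sym (+-assoc (digitVal d) _ _))

digitSum≤value : ∀ w → digitSum w ≤ value w
digitSum≤value []      = z≤n
digitSum≤value (d ∷ w) = begin
  digitVal d + digitSum w
    ≤⟨ +-mono-≤ (m≤m*n (digitVal d) (2 ^ length w) {{m^n≢0 2 (length w)}}) (digitSum≤value w) ⟩
  digitVal d * 2 ^ length w + value w   ≡⟨ sym (value-∷ d w) ⟩
  value (d ∷ w)                         ∎
  where open ≤-Reasoning

-- Arcs and paths

word : ∀ {n} → H n → Word
word = proj₁

leading-irrelevant : ∀ {w} (p q : LeadingNonzero w) → p ≡ q
leading-irrelevant lead-empty lead-empty = refl
leading-irrelevant lead-one   lead-one   = refl
leading-irrelevant lead-two   lead-two   = refl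

word-injective : ∀ {n} {u v : H n} → word u ≡ word v → u ≡ v
word-injective {u = w , p , e} {.w , q , e′} refl =
  cong₂ (λ p e → w , p , e) (leading-irrelevant p q) (≡-irrelevant e e′)

Arc : Word → Word → Set
Arc u w = Arrow u w ⊎ DArrow u w

arc-value : ∀ {u w} → Arc u w → value u ≡ value w
arc-value (inj₁ (arr-mid x y)) = value-replace x y (λ a → 4a+2 a)
  where
  4a+2 : ∀ a → 2 * (2 * a + 0) + 2 ≡ 2 * (2 * a + 1) + 0
  4a+2 = solve-∀
arc-value (inj₁ (arr-head y)) = refl
arc-value (inj₂ (darr x y))   = value-replace x y (λ a → 4a+4 a)
  where
  4a+4 : ∀ a → 2 * (2 * a + 1) + 2 ≡ 2 * (2 * a + 2) + 0
  4a+4 = solve-∀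

leading-∷ : ∀ {d u w} → LeadingNonzero (d ∷ u) → LeadingNonzero (d ∷ w)
leading-∷ = nonzero⇒leading ∘ leading-nonzero

arc-leading : ∀ {u w} → Arc u w → LeadingNonzero u → LeadingNonzero w
arc-leading (inj₁ (arr-mid []      y)) ()
arc-leading (inj₁ (arr-mid (_ ∷ _) y)) l = leading-∷ l
arc-leading (inj₁ (arr-head y))         _ = lead-one
arc-leading (inj₂ (darr []      y))     _ = lead-two
arc-leading (inj₂ (darr (_ ∷ _) y))     l = leading-∷ l

arc-isHyperbinary : ∀ {n u w} → Arc u w → IsHyperbinary n u → IsHyperbinary n w
arc-isHyperbinary a (l , e) = arc-leading a l , trans (sym (arc-value a)) e

arc-digitSum : ∀ {u w} → Arc u w → digitSum u ≡ suc (digitSum w)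
arc-digitSum (inj₁ (arr-mid x y)) = trans (digitSum-++ x (d0 ∷ d2 ∷ y))
  (trans (+-suc (digitSum x) _) (cong suc (sym (digitSum-++ x (d1 ∷ d0 ∷ y)))))
arc-digitSum (inj₁ (arr-head y))  = refl
arc-digitSum (inj₂ (darr x y))    = trans (digitSum-++ x (d1 ∷ d2 ∷ y))
  (trans (+-suc (digitSum x) _) (cong suc (sym (digitSum-++ x (d2 ∷ d0 ∷ y)))))

arc-length : ∀ {u w} → Arc u w → length u ≤ length w
arc-length (inj₁ (arr-mid x y)) = ≤-reflexive (trans (length-++ x) (sym (length-++ x)))
arc-length (inj₁ (arr-head y))  = n≤1+n _
arc-length (inj₂ (darr x y))    = ≤-reflexive (trans (length-++ x) (sym (length-++ x)))

infixr 5 _◅_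
infixl 5 _▻_

data Path : ℕ → Word → Word → Set where
  ε   : ∀ {u} → Path 0 u u
  _◅_ : ∀ {k u v w} → Arc u v → Path k v w → Path (suc k) u w

Reach : Word → Word → Set
Reach u w = ∃[ k ] Path k u w

_▻_ : ∀ {k u v w} → Path k u v → Arc v w → Path (suc k) u w
ε       ▻ a = a ◅ ε
(b ◅ p) ▻ a = b ◅ (p ▻ a)

path-digitSum : ∀ {k u w} → Path k u w → digitSum u ≡ k + digitSum w
path-digitSum ε       = refl
path-digitSum (a ◅ p) = trans (arc-digitSum a) (cong suc (path-digitSum p))

path-lengths-equal : ∀ {j k u w} → Path j u w → Path k u w → j ≡ k
path-lengths-equal {j} {k} {w = w} p q = +-cancelʳ-≡ (digitSum w) j k (trans (sym (path-digitSum p)) (path-digitSum q))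

path-value : ∀ {k u w} → Path k u w → value u ≡ value w
path-value ε       = refl
path-value (a ◅ p) = trans (arc-value a) (path-value p)

path-length : ∀ {k u w} → Path k u w → length u ≤ length w
path-length ε       = ≤-refl
path-length (a ◅ p) = ≤-trans (arc-length a) (path-length p)

path-isHyperbinary : ∀ {n k u w} → Path k u w → IsHyperbinary n u → IsHyperbinary n w
path-isHyperbinary ε       h = h
path-isHyperbinary (a ◅ p) h = path-isHyperbinary p (arc-isHyperbinary a h)

-- Embeddings and isomorphisms

⇔-refl : ∀ {A : Set} → A ⇔' A
⇔-refl = id , id

⇔-sym : ∀ {A B : Set} → A ⇔' B → B ⇔' A
⇔-sym (f , g) = g , f

⇔-trans : ∀ {A B C : Set} → A ⇔' B → B ⇔' C → A ⇔' C
⇔-trans (f , g) (h , k) = h ∘ f , g ∘ k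

≡⇒⇔ : ∀ (R : Word → Word → Set) {u v u′ v′} → u ≡ u′ → v ≡ v′ → R u v ⇔' R u′ v′
≡⇒⇔ R refl refl = ⇔-refl

record Embedding (a n : ℕ) : Set where
  field
    to        : H a → H n
    injective : ∀ u w → word (to u) ≡ word (to w) → word u ≡ word w
    arrow     : ∀ u w → Arrow (word u) (word w) ⇔' Arrow (word (to u)) (word (to w))
    darrow    : ∀ u w → DArrow (word u) (word w) ⇔' DArrow (word (to u)) (word (to w))

  arc : ∀ u w → Arc (word u) (word w) → Arc (word (to u)) (word (to w))
  arc u w (inj₁ a) = inj₁ (proj₁ (arrow u w) a)
  arc u w (inj₂ a) = inj₂ (proj₁ (darrow u w) a)

  arc⁻ : ∀ u w → Arc (word (to u)) (word (to w)) → Arc (word u) (word w)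
  arc⁻ u w (inj₁ a) = inj₁ (proj₂ (arrow u w) a)
  arc⁻ u w (inj₂ a) = inj₂ (proj₂ (darrow u w) a)

  path : ∀ {k} u w → Path k (word u) (word w) → Path k (word (to u)) (word (to w))
  path (u , hu) w ε       = subst (λ v → Path 0 (word (to (u , hu))) (word (to v))) (word-injective {u = u , hu} refl) ε
  path (u , hu) w (a ◅ p) = arc (u , hu) (_ , arc-isHyperbinary a hu) a ◅ path (_ , arc-isHyperbinary a hu) w p

  reach : ∀ u w → Reach (word u) (word w) → Reach (word (to u)) (word (to w))
  reach u w (k , p) = k , path u w p

_∘ᴱ_ : ∀ {a b c} → Embedding b c → Embedding a b → Embedding a c
F ∘ᴱ E = record
  { to        = F.to ∘ E.to
  ; injective = λ u w → E.injective u w ∘ F.injective (E.to u) (E.to w)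
  ; arrow     = λ u w → ⇔-trans (E.arrow u w) (F.arrow (E.to u) (E.to w))
  ; darrow    = λ u w → ⇔-trans (E.darrow u w) (F.darrow (E.to u) (E.to w))
  }
  where
  module E = Embedding E
  module F = Embedding F

Onto : ∀ {a n} → (H a → H n) → Set
Onto {a} {n} f = ∀ (v : H n) → ∃[ u ] word (f u) ≡ word v

embedding⇒iso : ∀ {a n} (E : Embedding a n) → Onto (Embedding.to E) → Isomorphic a n
embedding⇒iso E onto = record
  { to      = to
  ; from    = λ v → proj₁ (onto v)
  ; from∘to = λ u → injective _ u (proj₂ (onto (to u)))
  ; to∘from = λ v → proj₂ (onto v)
  ; arrow   = arrow
  ; darrow  = darrow
  }
  where open Embedding E

module _ {m n} (I : Isomorphic m n) where
  open Isomorphic I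

  iso⇒embedding : Embedding m n
  iso⇒embedding = record
    { to        = to
    ; injective = λ u w eq → trans (sym (from∘to u)) (trans (cong (word ∘ from) (word-injective eq)) (from∘to w))
    ; arrow     = arrow
    ; darrow    = darrow
    }

  iso-sym : Isomorphic n m
  iso-sym = record
    { to      = from
    ; from    = to
    ; from∘to = to∘from
    ; to∘from = from∘to
    ; arrow   = λ u w → ⇔-sym (⇔-trans (arrow (from u) (from w)) (≡⇒⇔ Arrow (to∘from u) (to∘from w)))
    ; darrow  = λ u w → ⇔-sym (⇔-trans (darrow (from u) (from w)) (≡⇒⇔ DArrow (to∘from u) (to∘from w)))
    }

iso-refl : ∀ n → Isomorphic n n
iso-refl n = record
  { to = id ; from = id ; from∘to = λ _ → refl ; to∘from = λ _ → refl
  ; arrow = λ _ _ → ⇔-refl ; darrow = λ _ _ → ⇔-refl }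

iso-trans : ∀ {a b c} → Isomorphic a b → Isomorphic b c → Isomorphic a c
iso-trans I J = embedding⇒iso (iso⇒embedding J ∘ᴱ iso⇒embedding I) onto
  where
  module I = Isomorphic I
  module J = Isomorphic J
  onto : Onto (J.to ∘ I.to)
  onto v = I.from (J.from v) , trans (cong (word ∘ J.to) (word-injective (I.to∘from (J.from v)))) (J.to∘from v)

-- In-neighbours

sourceDigits : ∀ {c} → NonzeroDigit c → Word
sourceDigits nz1 = d0 ∷ d2 ∷ []
sourceDigits nz2 = d1 ∷ d2 ∷ []

inNeighbour : ∀ {c} → NonzeroDigit c → Word → Word → Word
inNeighbour nz1 []      B = d2 ∷ B
inNeighbour nz1 (x ∷ A) B = (x ∷ A) ++ d0 ∷ d2 ∷ B
inNeighbour nz2 A       B = A ++ d1 ∷ d2 ∷ B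

inNeighbour-arc : ∀ {c} (nc : NonzeroDigit c) A B → Arc (inNeighbour nc A B) (A ++ c ∷ d0 ∷ B)
inNeighbour-arc nz1 []      B = inj₁ (arr-head B)
inNeighbour-arc nz1 (x ∷ A) B = inj₁ (arr-mid (x ∷ A) B)
inNeighbour-arc nz2 A       B = inj₂ (darr A B)

inNeighbour-leading : ∀ {c} (nc : NonzeroDigit c) A B →
                      LeadingNonzero (A ++ c ∷ d0 ∷ B) → LeadingNonzero (inNeighbour nc A B)
inNeighbour-leading nz1 []      B _ = lead-two
inNeighbour-leading nz1 (x ∷ A) B l = leading-∷ l
inNeighbour-leading nz2 []      B _ = lead-one
inNeighbour-leading nz2 (x ∷ A) B l = leading-∷ l

inNeighbour-after : ∀ {c} (nc : NonzeroDigit c) A x P C →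
                    inNeighbour nc (A ++ x ∷ P) C ≡ A ++ x ∷ P ++ sourceDigits nc ++ C
inNeighbour-after nz1 []      x P C = refl
inNeighbour-after nz1 (a ∷ A) x P C = cong (a ∷_) (++-assoc A (x ∷ P) _)
inNeighbour-after nz2 A       x P C = ++-assoc A (x ∷ P) _

inNeighbour-changes : ∀ {c} (nc : NonzeroDigit c) A B → ∃[ e ] ∃[ r ] inNeighbour nc A B ≡ A ++ e ∷ r × e ≢ c
inNeighbour-changes nz1 []      B = d2 , B , refl , λ ()
inNeighbour-changes nz1 (x ∷ A) B = d0 , d2 ∷ B , refl , λ ()
inNeighbour-changes nz2 A       B = d1 , d2 ∷ B , refl , λ ()

-- An occurrence w = x e 0 y with e ≠ 0: every arc into w rewrites one (`arc-factor`), and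
-- `source` is the word it comes from.
record Factor (w : Word) : Set where
  constructor factor
  field
    before  : Word
    {digit} : Digit
    nonzero : NonzeroDigit digit
    after   : Word
    split   : w ≡ before ++ digit ∷ d0 ∷ after

  source : Word
  source = inNeighbour nonzero before after

open Factor using (before; source)

arc-factor : ∀ {v w} → Arc v w → LeadingNonzero v → Σ (Factor w) λ f → v ≡ source f
arc-factor (inj₁ (arr-mid []      y)) ()
arc-factor (inj₁ (arr-mid (x ∷ X) y)) _ = factor (x ∷ X) nz1 y refl , refl
arc-factor (inj₁ (arr-head y))         _ = factor [] nz1 y refl , refl
arc-factor (inj₂ (darr x y))           _ = factor x nz2 y refl , refl

arrow-factor : ∀ {v w} → Arrow v w → ∃[ x ] ∃[ y ] w ≡ x ++ d1 ∷ d0 ∷ y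
arrow-factor (arr-mid x y) = x , y , refl
arrow-factor (arr-head y)  = [] , y , refl

zeroFree⇒¬factor : ∀ {w} → ZeroFree w → ¬ Factor w
zeroFree⇒¬factor zw (factor x _ y refl) with ++⁻ʳ x zw
... | _ ∷ () ∷ _

NoIn : ∀ {n} → H n → Set
NoIn {n} u = ∀ (v : H n) → ¬ Arc (word v) (word u)

UniqueIn : ∀ {n} → H n → Set
UniqueIn {n} u = Σ (H n) λ v → Arc (word v) (word u) × (∀ (v′ : H n) → Arc (word v′) (word u) → word v′ ≡ word v)

module _ {n : ℕ} where
  inNeighbourᴴ : (u : H n) → Factor (word u) → H n
  inNeighbourᴴ (_ , l , e) f@(factor A nc B eq) =
    source f , inNeighbour-leading nc A B (subst LeadingNonzero eq l) ,
    trans (arc-value (inNeighbour-arc nc A B)) (trans (cong value (sym eq)) e)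

  inNeighbourᴴ-arc : ∀ u f → Arc (word (inNeighbourᴴ u f)) (word u)
  inNeighbourᴴ-arc _ (factor A nc B eq) = subst (Arc _) (sym eq) (inNeighbour-arc nc A B)

  zeroFree⇒noIn : (u : H n) → ZeroFree (word u) → NoIn u
  zeroFree⇒noIn u zu (_ , l , _) a = zeroFree⇒¬factor zu (proj₁ (arc-factor a l))

FirstZero : Word → Set
FirstZero w = Σ (Factor w) (ZeroFree ∘ before)

private
  cons-split : ∀ {d w} → NonzeroDigit d → ZeroFree w ⊎ FirstZero w → ZeroFree (d ∷ w) ⊎ FirstZero (d ∷ w)
  cons-split {d} nd (inj₁ zw)                          = inj₁ (nd ∷ zw)
  cons-split {d} nd (inj₂ (factor A nc B eq , zA)) = inj₂ (factor (d ∷ A) nc B (cong (d ∷_) eq) , nd ∷ zA)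

  nonzero∷-split : ∀ {d} w → NonzeroDigit d → ZeroFree (d ∷ w) ⊎ FirstZero (d ∷ w)
  nonzero∷-split []       nd = inj₁ (nd ∷ [])
  nonzero∷-split (d0 ∷ w) nd = inj₂ (factor [] nd w refl , [])
  nonzero∷-split (d1 ∷ w) nd = cons-split nd (nonzero∷-split w nz1)
  nonzero∷-split (d2 ∷ w) nd = cons-split nd (nonzero∷-split w nz2)

zeroFree⊎firstZero : ∀ {w} → LeadingNonzero w → ZeroFree w ⊎ FirstZero w
zeroFree⊎firstZero lead-empty         = inj₁ []
zeroFree⊎firstZero {_ ∷ w} lead-one = nonzero∷-split w nz1
zeroFree⊎firstZero {_ ∷ w} lead-two = nonzero∷-split w nz2

noIn⇒zeroFree : ∀ {n} (u : H n) → NoIn u → ZeroFree (word u)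
noIn⇒zeroFree u noIn with zeroFree⊎firstZero (proj₁ (proj₂ u))
... | inj₁ zu      = zu
... | inj₂ (f , _) = ⊥-elim (noIn (inNeighbourᴴ u f) (inNeighbourᴴ-arc u f))

zeroRun : ∀ B → ∃[ k ] ∃[ Z ] B ≡ zeros k ++ Z × LeadingNonzero Z
zeroRun []       = 0 , [] , refl , lead-empty
zeroRun (d0 ∷ B) with k , Z , refl , l ← zeroRun B = suc k , Z , refl , l
zeroRun (d1 ∷ B) = 0 , d1 ∷ B , refl , lead-one
zeroRun (d2 ∷ B) = 0 , d2 ∷ B , refl , lead-two

record SingleZeroRun (w : Word) : Set where
  constructor run
  field
    X          : Word
    {c}        : Digit
    c-nonzero  : NonzeroDigit c
    k          : ℕ
    Y          : Word
    split      : w ≡ X ++ c ∷ zeros (suc k) ++ Y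
    X-zeroFree : ZeroFree X
    Y-zeroFree : ZeroFree Y

  runFactor : Factor w
  runFactor = factor X c-nonzero (zeros k ++ Y) split

twoRuns⇒¬uniqueIn : ∀ {n} (u : H n) A {c₁ c₂} (n₁ : NonzeroDigit c₁) B (n₂ : NonzeroDigit c₂) C →
                    word u ≡ A ++ c₁ ∷ d0 ∷ B ++ c₂ ∷ d0 ∷ C → ¬ UniqueIn u
twoRuns⇒¬uniqueIn u A {c₁} n₁ B n₂ C eq (v , _ , unique)
  with e , r , first , e≢c₁ ← inNeighbour-changes n₁ A (B ++ _ ∷ d0 ∷ C) =
  e≢c₁ (∷-injectiveˡ (++-cancelˡ A (e ∷ r) _ (begin
    A ++ e ∷ r                                  ≡⟨ sym first ⟩
    word (inNeighbourᴴ u f₁)                    ≡⟨ unique (inNeighbourᴴ u f₁) (inNeighbourᴴ-arc u f₁) ⟩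
    word v                                      ≡⟨ sym (unique (inNeighbourᴴ u f₂) (inNeighbourᴴ-arc u f₂)) ⟩
    word (inNeighbourᴴ u f₂)                    ≡⟨ inNeighbour-after n₂ A c₁ (d0 ∷ B) C ⟩
    A ++ c₁ ∷ (d0 ∷ B) ++ sourceDigits n₂ ++ C          ∎)))
  where
  open ≡-Reasoning
  f₁ : Factor (word u)
  f₁ = factor A n₁ (B ++ _ ∷ d0 ∷ C) eq
  f₂ : Factor (word u)
  f₂ = factor (A ++ c₁ ∷ d0 ∷ B) n₂ C (trans eq (sym (++-assoc A (c₁ ∷ d0 ∷ B) _)))

uniqueIn⇒singleRun : ∀ {n} (u : H n) → UniqueIn u → SingleZeroRun (word u)
uniqueIn⇒singleRun u uin@(v , a , _) with zeroFree⊎firstZero (proj₁ (proj₂ u))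
... | inj₁ zu = ⊥-elim (zeroFree⇒noIn u zu v a)
... | inj₂ (factor A nc B eq , zA) with zeroRun B
... | k , Z , refl , lZ with zeroFree⊎firstZero lZ
... | inj₁ zZ = run A nc k Z eq zA zZ
... | inj₂ (factor A₂ nc₂ B₂ refl , _) =
  ⊥-elim (twoRuns⇒¬uniqueIn u A nc (zeros k ++ A₂) nc₂ B₂
           (trans eq (cong (λ T → A ++ _ ∷ d0 ∷ T) (sym (++-assoc (zeros k) A₂ _)))) uin)

nonzero-irrelevant : ∀ {d} (p q : NonzeroDigit d) → p ≡ q
nonzero-irrelevant nz1 nz1 = refl
nonzero-irrelevant nz2 nz2 = refl

zeros-++-¬factor : ∀ k {Y} → ZeroFree Y → ¬ Factor (zeros k ++ Y)
zeros-++-¬factor zero    zY f                      = zeroFree⇒¬factor zY f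
zeros-++-¬factor (suc k) zY (factor []      ne y eq) = nonzero⇒≢d0 ne (sym (∷-injectiveˡ eq))
zeros-++-¬factor (suc k) zY (factor (_ ∷ x) ne y eq) = zeros-++-¬factor k zY (factor x ne y (∷-injectiveʳ eq))

zeroFree-++-nonzero : ∀ X {c T y} → ZeroFree X → NonzeroDigit c → X ++ c ∷ T ≢ d0 ∷ y
zeroFree-++-nonzero []      _          nc eq = nonzero⇒≢d0 nc (∷-injectiveˡ eq)
zeroFree-++-nonzero (_ ∷ X) (nx ∷ _) _  eq = nonzero⇒≢d0 nx (∷-injectiveˡ eq)

runSplit-unique : ∀ X {c} k Y x {e} y → ZeroFree X → NonzeroDigit c → ZeroFree Y → NonzeroDigit e →
                  X ++ c ∷ zeros (suc k) ++ Y ≡ x ++ e ∷ d0 ∷ y → x ≡ X × e ≡ c × y ≡ zeros k ++ Y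
runSplit-unique []      k Y []      y _ _ _ _ eq with refl , eq′ ← ∷-injective eq = refl , refl , sym (∷-injectiveʳ eq′)
runSplit-unique []      k Y (_ ∷ x) y _ _ zY ne eq =
  ⊥-elim (zeros-++-¬factor (suc k) zY (factor x ne y (∷-injectiveʳ eq)))
runSplit-unique (_ ∷ X) k Y []      y (_ ∷ zX) nc _ _ eq = ⊥-elim (zeroFree-++-nonzero X zX nc (∷-injectiveʳ eq))
runSplit-unique (_ ∷ X) k Y (_ ∷ x) y (_ ∷ zX) nc zY ne eq
  with refl , eq′ ← ∷-injective eq
  with refl , refl , refl ← runSplit-unique X k Y x y zX nc zY ne eq′ = refl , refl , refl

module SingleZeroRunProperties {w} (r : SingleZeroRun w) where
  open SingleZeroRun r

  source-unique : ∀ {v} → Arc v w → LeadingNonzero v → v ≡ source runFactor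
  source-unique a l with factor x ne y eq , refl ← arc-factor a l
    with refl , refl , refl ← runSplit-unique X k Y x y X-zeroFree c-nonzero Y-zeroFree ne (trans (sym split) eq)
    = cong (λ p → inNeighbour p X (zeros k ++ Y)) (nonzero-irrelevant ne c-nonzero)

  arrow⇒c≡d1 : ∀ {v} → Arrow v w → c ≡ d1
  arrow⇒c≡d1 a with x , y , eq ← arrow-factor a
    with _ , e≡c , _ ← runSplit-unique X k Y x y X-zeroFree c-nonzero Y-zeroFree nz1 (trans (sym split) eq)
    = sym e≡c

singleRun⇒uniqueIn : ∀ {n} (u : H n) → SingleZeroRun (word u) → UniqueIn u
singleRun⇒uniqueIn u r =
  inNeighbourᴴ u runFactor , inNeighbourᴴ-arc u runFactor , λ v a → source-unique a (proj₁ (proj₂ v))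
  where
  open SingleZeroRun r using (runFactor)
  open SingleZeroRunProperties r

-- Walk backwards along in-arcs: each raises the digit sum, which is bounded by n.
zeroFree-reaches : ∀ {n s} → ZeroFree s → value s ≡ n → (u : H n) → Reach s (word u)
zeroFree-reaches {n} {s} zs vs u = <-rec Reaches step (n ∸ digitSum (word u)) u refl
  where
  Reaches : ℕ → Set
  Reaches m = ∀ (u : H n) → n ∸ digitSum (word u) ≡ m → Reach s (word u)
  step : ∀ m → (∀ {m′} → m′ < m → Reaches m′) → Reaches m
  step _ rec u@(w , l , e) refl with zeroFree⊎firstZero l
  ... | inj₁ zw = 0 , subst (Path 0 s) (zeroFree-injective zs zw (trans vs (sym e))) ε
  ... | inj₂ (f , _) = let k , p = rec closer v refl in suc k , p ▻ inNeighbourᴴ-arc u f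
    where
    v : H n
    v = inNeighbourᴴ u f
    closer : n ∸ digitSum (word v) < n ∸ digitSum w
    closer = ∸-monoʳ-< (≤-reflexive (sym (arc-digitSum (inNeighbourᴴ-arc u f))))
                       (subst (digitSum (word v) ≤_) (proj₂ (proj₂ v)) (digitSum≤value (word v)))

-- A(a) as the induced subgraph of A(n) on the vertices reachable from the image of a zero-free
-- vertex.
record ReachEmbedding (a n : ℕ) : Set where
  field
    embedding     : Embedding a n
    root          : H a
    root-zeroFree : ZeroFree (word root)
  open Embedding embedding public
  field
    onto-reachable : ∀ (v : H n) → Reach (word (to root)) (word v) → ∃[ u ] word (to u) ≡ word v

  base : Word
  base = word (to root)

  reachable : ∀ u → Reach base (word (to u))
  reachable u = reach root u (zeroFree-reaches root-zeroFree (proj₂ (proj₂ root)) u)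

iso-reach : ∀ {n m} (I : Isomorphic n m) {x y : H n} {s} → word (Isomorphic.to I x) ≡ s →
            Reach (word x) (word y) → Reach s (word (Isomorphic.to I y))
iso-reach I {x} {y} refl = Embedding.reach (iso⇒embedding I) x y

module _ {a b n m} (E : ReachEmbedding a n) (F : ReachEmbedding b m) (I : Isomorphic n m)
         (bases : word (Isomorphic.to I (ReachEmbedding.to E (ReachEmbedding.root E))) ≡ ReachEmbedding.base F) where
  private
    module E = ReachEmbedding E
    module F = ReachEmbedding F
    module I = Isomorphic I
    G : Embedding a m
    G = iso⇒embedding I ∘ᴱ E.embedding
    module G = Embedding G

    bases⁻ : word (I.from (F.to F.root)) ≡ E.base
    bases⁻ = trans (cong (word ∘ I.from) (word-injective (sym bases))) (I.from∘to (E.to E.root))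

    lift : (u : H a) → ∃[ v ] word (F.to v) ≡ word (G.to u)
    lift u = F.onto-reachable (G.to u) (iso-reach I bases (E.reachable u))

    restrictTo : H a → H b
    restrictTo = proj₁ ∘ lift

    restrictTo-spec : ∀ u → word (F.to (restrictTo u)) ≡ word (G.to u)
    restrictTo-spec = proj₂ ∘ lift

    restriction : Embedding a b
    restriction = record
      { to        = restrictTo
      ; injective = λ u w eq → G.injective u w
          (trans (sym (restrictTo-spec u)) (trans (cong (word ∘ F.to) (word-injective eq)) (restrictTo-spec w)))
      ; arrow     = λ u w → ⇔-trans (G.arrow u w)
          (⇔-sym (⇔-trans (F.arrow (restrictTo u) (restrictTo w)) (≡⇒⇔ Arrow (restrictTo-spec u) (restrictTo-spec w))))
      ; darrow    = λ u w → ⇔-trans (G.darrow u w)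
          (⇔-sym (⇔-trans (F.darrow (restrictTo u) (restrictTo w)) (≡⇒⇔ DArrow (restrictTo-spec u) (restrictTo-spec w))))
      }

    onto : Onto restrictTo
    onto v with u , eu ← E.onto-reachable (I.from (F.to v)) (iso-reach (iso-sym I) bases⁻ (F.reachable v)) =
      u , F.injective (restrictTo u) v (begin
        word (F.to (restrictTo u))     ≡⟨ restrictTo-spec u ⟩
        word (I.to (E.to u))           ≡⟨ cong (word ∘ I.to) (word-injective eu) ⟩
        word (I.to (I.from (F.to v)))  ≡⟨ I.to∘from (F.to v) ⟩
        word (F.to v)                  ∎)
      where open ≡-Reasoning

  restrict : Isomorphic a b
  restrict = embedding⇒iso restriction onto

-- Appending a digit

++-∷ʳ : ∀ x (ys : Word) e → x ++ (ys ∷ʳ e) ≡ (x ++ ys) ∷ʳ e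
++-∷ʳ x ys e = sym (++-assoc x ys (e ∷ []))

arrow-∷ʳ⁺ : ∀ {u w} d → Arrow u w → Arrow (u ∷ʳ d) (w ∷ʳ d)
arrow-∷ʳ⁺ d (arr-mid x y) =
  subst₂ Arrow (++-∷ʳ x (d0 ∷ d2 ∷ y) d) (++-∷ʳ x (d1 ∷ d0 ∷ y) d) (arr-mid x (y ∷ʳ d))
arrow-∷ʳ⁺ d (arr-head y)  = arr-head (y ∷ʳ d)

darrow-∷ʳ⁺ : ∀ {u w} d → DArrow u w → DArrow (u ∷ʳ d) (w ∷ʳ d)
darrow-∷ʳ⁺ d (darr x y) =
  subst₂ DArrow (++-∷ʳ x (d1 ∷ d2 ∷ y) d) (++-∷ʳ x (d2 ∷ d0 ∷ y) d) (darr x (y ∷ʳ d))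

Peel : (Word → Word → Set) → Digit → Set
Peel R d = ∀ {s t u} → R s t → s ≡ u ∷ʳ d → d ≢ d2 → ∃[ w ] t ≡ w ∷ʳ d × R u w

arrow-peel : ∀ {d} → Peel Arrow d
arrow-peel (arr-mid x y) es d≢2 with initLast y
... | [] = ⊥-elim (d≢2 (sym (proj₂ (∷ʳ-injective (x ∷ʳ d0) _ (trans (sym (++-∷ʳ x (d0 ∷ []) d2)) es)))))
... | y′ ∷ʳ′ e
  with refl , refl ← ∷ʳ-injective (x ++ d0 ∷ d2 ∷ y′) _ (trans (sym (++-∷ʳ x (d0 ∷ d2 ∷ y′) e)) es) =
  x ++ d1 ∷ d0 ∷ y′ , ++-∷ʳ x (d1 ∷ d0 ∷ y′) e , arr-mid x y′
arrow-peel (arr-head y) es d≢2 with initLast y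
... | [] = ⊥-elim (d≢2 (sym (proj₂ (∷ʳ-injective [] _ es))))
... | y′ ∷ʳ′ e with refl , refl ← ∷ʳ-injective (d2 ∷ y′) _ es = d1 ∷ d0 ∷ y′ , refl , arr-head y′

darrow-peel : ∀ {d} → Peel DArrow d
darrow-peel (darr x y) es d≢2 with initLast y
... | [] = ⊥-elim (d≢2 (sym (proj₂ (∷ʳ-injective (x ∷ʳ d1) _ (trans (sym (++-∷ʳ x (d1 ∷ []) d2)) es)))))
... | y′ ∷ʳ′ e
  with refl , refl ← ∷ʳ-injective (x ++ d1 ∷ d2 ∷ y′) _ (trans (sym (++-∷ʳ x (d1 ∷ d2 ∷ y′) e)) es) =
  x ++ d2 ∷ d0 ∷ y′ , ++-∷ʳ x (d2 ∷ d0 ∷ y′) e , darr x y′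

peel-reflects : ∀ {R d} → Peel R d → d ≢ d2 → ∀ {u w} → R (u ∷ʳ d) (w ∷ʳ d) → R u w
peel-reflects {R} peel d≢2 r with _ , eq , r′ ← peel r refl d≢2 = subst (R _) (sym (proj₁ (∷ʳ-injective _ _ eq))) r′

path-∷ʳ⁻ : ∀ {k s t u d} → Path k s t → s ≡ u ∷ʳ d → d ≢ d2 → ∃[ w ] t ≡ w ∷ʳ d
path-∷ʳ⁻ ε                es _   = _ , es
path-∷ʳ⁻ (inj₁ a ◅ p) es d≢2 = let _ , et , _ = arrow-peel a es d≢2 in path-∷ʳ⁻ p et d≢2
path-∷ʳ⁻ (inj₂ a ◅ p) es d≢2 = let _ , et , _ = darrow-peel a es d≢2 in path-∷ʳ⁻ p et d≢2

leading-∷ʳ⁺ : ∀ {w d} → LeadingNonzero w → (w ≡ [] → NonzeroDigit d) → LeadingNonzero (w ∷ʳ d)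
leading-∷ʳ⁺ {[]}    _ nd = nonzero⇒leading (nd refl)
leading-∷ʳ⁺ {_ ∷ _} l _  = leading-∷ l

leading-∷ʳ⁻ : ∀ {w d} → LeadingNonzero (w ∷ʳ d) → LeadingNonzero w
leading-∷ʳ⁻ {[]}    _ = lead-empty
leading-∷ʳ⁻ {_ ∷ _} l = leading-∷ l

module _ {W d n} (zW : ZeroFree W) (d≢2 : d ≢ d2) (nonempty : 0 < value W ⊎ NonzeroDigit d)
         (W∷ʳd≡n : value (W ∷ʳ d) ≡ n) where
  private
    value-∷ʳ-cong : ∀ {w} → value w ≡ value W → value (w ∷ʳ d) ≡ value (W ∷ʳ d)
    value-∷ʳ-cong {w} e = trans (value-∷ʳ w d) (trans (cong (λ v → 2 * v + digitVal d) e) (sym (value-∷ʳ W d)))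

    value-∷ʳ-cancel : ∀ {w} → value (w ∷ʳ d) ≡ value (W ∷ʳ d) → value w ≡ value W
    value-∷ʳ-cancel {w} e =
      *-cancelˡ-≡ _ _ 2 (+-cancelʳ-≡ (digitVal d) _ _ (trans (sym (value-∷ʳ w d)) (trans e (value-∷ʳ W d))))

    last-nonzero : ∀ {w} → value w ≡ value W → w ≡ [] → NonzeroDigit d
    last-nonzero e refl = [ (λ 0<W → ⊥-elim (<⇒≢ 0<W e)) , id ]′ nonempty

    snoc : H (value W) → H n
    snoc (w , l , e) = w ∷ʳ d , leading-∷ʳ⁺ l (last-nonzero e) , trans (value-∷ʳ-cong {w} e) W∷ʳd≡n

    onto-reachable : ∀ v → Reach (W ∷ʳ d) (word v) → ∃[ u ] word (snoc u) ≡ word v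
    onto-reachable (v , l , e) (_ , p) with w , refl ← path-∷ʳ⁻ p refl d≢2 =
      (w , leading-∷ʳ⁻ l , value-∷ʳ-cancel {w} (trans e (sym W∷ʳd≡n))) , refl

  snocEmbedding : ReachEmbedding (value W) n
  snocEmbedding = record
    { embedding      = record
      { to        = snoc
      ; injective = λ u w eq → proj₁ (∷ʳ-injective (word u) (word w) eq)
      ; arrow     = λ _ _ → arrow-∷ʳ⁺ d , peel-reflects arrow-peel d≢2
      ; darrow    = λ _ _ → darrow-∷ʳ⁺ d , peel-reflects darrow-peel d≢2
      }
    ; root           = W , zeroFree⇒leading zW , refl
    ; root-zeroFree  = zW
    ; onto-reachable = onto-reachable
    }

identityEmbedding : ∀ {W} → ZeroFree W → ReachEmbedding (value W) (value W)
identityEmbedding {W} zW = record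
  { embedding      = iso⇒embedding (iso-refl (value W))
  ; root           = W , zeroFree⇒leading zW , refl
  ; root-zeroFree  = zW
  ; onto-reachable = λ v _ → v , refl
  }

iso-2*n+1 : ∀ n → Isomorphic n (2 * n + 1)
iso-2*n+1 n with W , zW , refl ← zeroFree-expansion n =
  subst (Isomorphic (value W)) (value-∷ʳ W d1)
    (restrict (snocEmbedding zW (λ ()) (inj₂ nz1) refl) (identityEmbedding (∷ʳ⁺ zW nz1)) (iso-refl _) refl)

-- Appending binary ones

-- 2^t (n + 1) - 1 is the binary expansion of n followed by t ones.
appendOnes : ℕ → ℕ → ℕ
appendOnes t n = (2 ^ t * n + 2 ^ t) ∸ 1

Related : ℕ → ℕ → Set
Related m n = ∃ λ t → (m ≡ appendOnes t n) ⊎ (n ≡ appendOnes t m)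

appendOnes+1 : ∀ t n → appendOnes t n + 1 ≡ 2 ^ t * suc n
appendOnes+1 t n = trans (m∸n+n≡m (≤-trans (m^n>0 2 t) (m≤n+m _ _)))
                         (trans (+-comm (2 ^ t * n) (2 ^ t)) (sym (*-suc (2 ^ t) n)))

appendOnes-unique : ∀ {m} t n → m + 1 ≡ 2 ^ t * suc n → m ≡ appendOnes t n
appendOnes-unique t n eq = +-cancelʳ-≡ 1 _ _ (trans eq (sym (appendOnes+1 t n)))

appendOnes-zero : ∀ n → appendOnes 0 n ≡ n
appendOnes-zero n = sym (appendOnes-unique 0 n (trans (+-comm n 1) (sym (*-identityˡ (suc n)))))

appendOnes-suc : ∀ t n → appendOnes (suc t) n ≡ 2 * appendOnes t n + 1
appendOnes-suc t n = sym (appendOnes-unique (suc t) n (begin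
  2 * appendOnes t n + 1 + 1   ≡⟨ double+2 (appendOnes t n) ⟩
  2 * (appendOnes t n + 1)     ≡⟨ cong (2 *_) (appendOnes+1 t n) ⟩
  2 * (2 ^ t * suc n)          ≡⟨ sym (*-assoc 2 (2 ^ t) (suc n)) ⟩
  2 ^ suc t * suc n            ∎))
  where
  open ≡-Reasoning
  double+2 : ∀ x → 2 * x + 1 + 1 ≡ 2 * (x + 1)
  double+2 = solve-∀

appendOnes-suc-inner : ∀ t n → appendOnes (suc t) n ≡ appendOnes t (2 * n + 1)
appendOnes-suc-inner t n = appendOnes-unique t (2 * n + 1) (trans (appendOnes+1 (suc t) n) (regroup (2 ^ t) n))
  where
  regroup : ∀ P n → 2 * P * suc n ≡ P * suc (2 * n + 1)
  regroup = solve-∀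

appendOnes-even : ∀ t n → 2 ∣ appendOnes t n → appendOnes t n ≡ n
appendOnes-even zero    n _  = appendOnes-zero n
appendOnes-even (suc t) n 2∣ = ⊥-elim (2∤2*m+1 (appendOnes t n) (subst (2 ∣_) (appendOnes-suc t n) 2∣))

related-sym : ∀ {m n} → Related m n → Related n m
related-sym (t , inj₁ eq) = t , inj₂ eq
related-sym (t , inj₂ eq) = t , inj₁ eq

related-2*m+1 : ∀ {m n} → Related m n → Related (2 * m + 1) n
related-2*m+1 {m} {n} (t , inj₁ m≡) =
  suc t , inj₁ (trans (cong (λ x → 2 * x + 1) m≡) (sym (appendOnes-suc t n)))
related-2*m+1 {m} {n} (zero , inj₂ n≡) =
  1 , inj₁ (trans (cong (λ x → 2 * x + 1) (sym (trans n≡ (appendOnes-zero m))))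
                  (sym (trans (appendOnes-suc 0 n) (cong (λ x → 2 * x + 1) (appendOnes-zero n)))))
related-2*m+1 {m} {n} (suc t , inj₂ n≡) = t , inj₂ (trans n≡ (appendOnes-suc-inner t m))

related-even : ∀ {m n} → 2 ∣ m → 2 ∣ n → Related m n → m ≡ n
related-even 2∣m _   (t , inj₁ refl) = appendOnes-even t _ 2∣m
related-even _   2∣n (t , inj₂ refl) = sym (appendOnes-even t _ 2∣n)

related-even-odd : ∀ {m n} → 2 ∣ m → ¬ 2 ∣ n → Related m n → ∃[ t ] n ≡ appendOnes t m
related-even-odd 2∣m 2∤n (t , inj₁ refl) = ⊥-elim (2∤n (subst (2 ∣_) (appendOnes-even t _ 2∣m) 2∣m))
related-even-odd _   _   (t , inj₂ eq)   = t , eq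

iso-appendOnes : ∀ t n → Isomorphic n (appendOnes t n)
iso-appendOnes zero    n = subst (Isomorphic n) (sym (appendOnes-zero n)) (iso-refl n)
iso-appendOnes (suc t) n =
  subst (Isomorphic n) (sym (appendOnes-suc t n)) (iso-trans (iso-appendOnes t n) (iso-2*n+1 _))

related⇒isomorphic : ∀ {m n} → Related m n → Isomorphic m n
related⇒isomorphic (t , inj₁ refl) = iso-sym (iso-appendOnes t _)
related⇒isomorphic (t , inj₂ refl) = iso-appendOnes t _

-- Padding with 1 0^p

¬leading-d0 : ∀ {w} → ¬ LeadingNonzero (d0 ∷ w)
¬leading-d0 ()

zeros-shift : ∀ q T → zeros q ++ d0 ∷ T ≡ d0 ∷ zeros q ++ T
zeros-shift zero    T = refl
zeros-shift (suc q) T = cong (d0 ∷_) (zeros-shift q T)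

zeros-++-injective : ∀ p q {u w} → LeadingNonzero u → LeadingNonzero w →
                     zeros p ++ u ≡ zeros q ++ w → p ≡ q × u ≡ w
zeros-++-injective zero    zero    _  _  eq   = refl , eq
zeros-++-injective zero    (suc q) lu _  refl = ⊥-elim (¬leading-d0 lu)
zeros-++-injective (suc p) zero    _  lw refl = ⊥-elim (¬leading-d0 lw)
zeros-++-injective (suc p) (suc q) lu lw eq
  with refl , u≡w ← zeros-++-injective p q lu lw (∷-injectiveʳ eq) = refl , u≡w

value-ones+1 : ∀ k → value (ones k) + 1 ≡ 2 ^ k
value-ones+1 zero    = refl
value-ones+1 (suc k) = begin
  value (d1 ∷ ones k) + 1                  ≡⟨ cong (_+ 1) (value-∷ d1 (ones k)) ⟩
  1 * 2 ^ length (ones k) + value (ones k) + 1 ≡⟨ cong (λ l → 1 * 2 ^ l + value (ones k) + 1) (length-replicate k) ⟩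
  1 * 2 ^ k + value (ones k) + 1           ≡⟨ regroup (2 ^ k) (value (ones k)) ⟩
  2 ^ k + (value (ones k) + 1)             ≡⟨ cong (2 ^ k +_) (value-ones+1 k) ⟩
  2 ^ k + 2 ^ k                            ≡⟨ cong (2 ^ k +_) (sym (+-identityʳ (2 ^ k))) ⟩
  2 ^ suc k                                ∎
  where
  open ≡-Reasoning
  regroup : ∀ P v → 1 * P + v + 1 ≡ P + (v + 1)
  regroup = solve-∀

value-ones-2-++ : ∀ α R → value (ones α ++ d2 ∷ R) ≡ 2 ^ (suc α + length R) + value R
value-ones-2-++ α R = begin
  value (ones α ++ d2 ∷ R)                       ≡⟨ cong value (sym (++-assoc (ones α) (d2 ∷ []) R)) ⟩
  value ((ones α ∷ʳ d2) ++ R)                    ≡⟨ value-++ (ones α ∷ʳ d2) R ⟩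
  value (ones α ∷ʳ d2) * 2 ^ length R + value R  ≡⟨ cong (λ v → v * 2 ^ length R + value R) ones-2 ⟩
  2 ^ suc α * 2 ^ length R + value R             ≡⟨ cong (_+ value R) (sym (^-distribˡ-+-* 2 (suc α) (length R))) ⟩
  2 ^ (suc α + length R) + value R               ∎
  where
  open ≡-Reasoning
  ones-2 : value (ones α ∷ʳ d2) ≡ 2 ^ suc α
  ones-2 = trans (value-∷ʳ (ones α) d2) (trans (sym (*-distribˡ-+ 2 (value (ones α)) 1)) (cong (2 *_) (value-ones+1 α)))

padded : ℕ → Word → Word
padded p w = d1 ∷ zeros p ++ w

length-padded : ∀ p w → length (padded p w) ≡ suc (p + length w)
length-padded p w = cong suc (trans (length-++ (zeros p)) (cong (_+ length w) (length-replicate p)))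

value-padded : ∀ p w → value (padded p w) ≡ 2 ^ (p + length w) + value w
value-padded p w = begin
  value (padded p w)                                      ≡⟨ value-∷ d1 (zeros p ++ w) ⟩
  1 * 2 ^ length (zeros p ++ w) + value (zeros p ++ w)    ≡⟨ cong₂ _+_ (*-identityˡ _) (value-zeros-++ p w) ⟩
  2 ^ length (zeros p ++ w) + value w
    ≡⟨ cong (λ l → 2 ^ l + value w) (suc-injective (length-padded p w)) ⟩
  2 ^ (p + length w) + value w                            ∎
  where open ≡-Reasoning

zeros-arrow : ∀ p q {u w} x y → LeadingNonzero u → LeadingNonzero w →
              zeros p ++ u ≡ x ++ d0 ∷ d2 ∷ y → zeros q ++ w ≡ x ++ d1 ∷ d0 ∷ y → Arrow u w
zeros-arrow zero          zero    x       y _  _  refl refl = arr-mid x y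
zeros-arrow (suc p)       (suc q) []      y _  _  _    ()
zeros-arrow (suc p)       (suc q) (_ ∷ x) y lu lw es   et   =
  zeros-arrow p q x y lu lw (∷-injectiveʳ es) (∷-injectiveʳ et)
zeros-arrow (suc zero)    zero    []      y _  _  refl refl = arr-head y
zeros-arrow (suc (suc p)) zero    []      y _  _  ()   _
zeros-arrow (suc p)       zero    (a ∷ x) y _  lw es   refl with refl ← ∷-injectiveˡ es = ⊥-elim (¬leading-d0 lw)
zeros-arrow zero          (suc q) []      y lu _  refl _    = ⊥-elim (¬leading-d0 lu)
zeros-arrow zero          (suc q) (a ∷ x) y lu _  refl et   with refl ← ∷-injectiveˡ et = ⊥-elim (¬leading-d0 lu)

zeros-darrow : ∀ p q {u w} x y → LeadingNonzero u → LeadingNonzero w →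
               zeros p ++ u ≡ x ++ d1 ∷ d2 ∷ y → zeros q ++ w ≡ x ++ d2 ∷ d0 ∷ y → DArrow u w
zeros-darrow zero    zero    x       y _  _  refl refl = darr x y
zeros-darrow (suc p) _       []      y _  _  ()   _
zeros-darrow zero    (suc q) []      y _  _  _    ()
zeros-darrow (suc p) (suc q) (_ ∷ x) y lu lw es   et   =
  zeros-darrow p q x y lu lw (∷-injectiveʳ es) (∷-injectiveʳ et)
zeros-darrow (suc p) zero    (a ∷ x) y _  lw es   refl with refl ← ∷-injectiveˡ es = ⊥-elim (¬leading-d0 lw)
zeros-darrow zero    (suc q) (a ∷ x) y lu _  refl et   with refl ← ∷-injectiveˡ et = ⊥-elim (¬leading-d0 lu)

module _ {p q : ℕ} {u w} (lu : LeadingNonzero u) (lw : LeadingNonzero w) where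
  padded-arrow⁻ : ∀ {s t} → Arrow s t → s ≡ padded p u → t ≡ padded q w → Arrow u w
  padded-arrow⁻ (arr-mid []      y) () _
  padded-arrow⁻ (arr-mid (_ ∷ x) y) es et = zeros-arrow p q x y lu lw (sym (∷-injectiveʳ es)) (sym (∷-injectiveʳ et))
  padded-arrow⁻ (arr-head y)         () _

  padded-darrow⁻ : ∀ {s t} → DArrow s t → s ≡ padded p u → t ≡ padded q w → DArrow u w
  padded-darrow⁻ (darr []      y) _ ()
  padded-darrow⁻ (darr (_ ∷ x) y) es et = zeros-darrow p q x y lu lw (sym (∷-injectiveʳ es)) (sym (∷-injectiveʳ et))

padded-++ : ∀ p x T → padded p (x ++ T) ≡ (d1 ∷ zeros p ++ x) ++ T
padded-++ p x T = cong (d1 ∷_) (sym (++-assoc (zeros p) x T))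

same-length : ∀ {p q} x {a b c d : Digit} y →
              p + length (x ++ a ∷ b ∷ y) ≡ q + length (x ++ c ∷ d ∷ y) → p ≡ q
same-length x y eq = +-cancelʳ-≡ _ _ _ (trans eq (cong (_ +_) (trans (length-++ x) (sym (length-++ x)))))

padded-arrow⁺ : ∀ p q {u w} → p + length u ≡ q + length w → Arrow u w → Arrow (padded p u) (padded q w)
padded-arrow⁺ p q eq (arr-mid x y) with refl ← same-length x y eq =
  subst₂ Arrow (sym (padded-++ p x _)) (sym (padded-++ p x _)) (arr-mid (d1 ∷ zeros p ++ x) y)
padded-arrow⁺ p q eq (arr-head y)
  with refl ← +-cancelʳ-≡ (suc (length y)) p (suc q) (trans eq (+-suc q (suc (length y)))) =
  subst (λ s → Arrow (d1 ∷ s) (padded q (d1 ∷ d0 ∷ y))) (zeros-shift q (d2 ∷ y)) (arr-mid (d1 ∷ zeros q) y)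

padded-darrow⁺ : ∀ p q {u w} → p + length u ≡ q + length w → DArrow u w → DArrow (padded p u) (padded q w)
padded-darrow⁺ p q eq (darr x y) with refl ← same-length x y eq =
  subst₂ DArrow (sym (padded-++ p x _)) (sym (padded-++ p x _)) (darr (d1 ∷ zeros p ++ x) y)

-- With M = value (1^α 2 R) and ℓ = α + 1 + |R|, the map w ↦ 1 0^(ℓ ∸ |w|) w identifies A(value R)
-- with the vertices of A(M) reachable from the anchor 1 0^(α+1) R.
module Padding (α : ℕ) {R : Word} (zR : ZeroFree R) where
  M : ℕ
  M = value (ones α ++ d2 ∷ R)

  ℓ : ℕ
  ℓ = suc α + length R

  M≡ : M ≡ 2 ^ ℓ + value R
  M≡ = value-ones-2-++ α R

  R<2^ℓ : value R < 2 ^ ℓ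
  R<2^ℓ = <-≤-trans (value<2^1+length R) (^-monoʳ-≤ 2 (s≤s (m≤n+m (length R) α)))

  R<M : value R < M
  R<M = subst (value R <_) (sym M≡) (m<n+m (value R) (m^n>0 2 ℓ))

  M<2^1+ℓ : M < 2 ^ suc ℓ
  M<2^1+ℓ = subst (_< 2 ^ suc ℓ) (sym M≡) (2^m+x<2^n {ℓ} R<2^ℓ ≤-refl)

  even-M : 2 ∣ value R → 2 ∣ M
  even-M eR = subst (2 ∣_) (sym M≡) (∣m∣n⇒∣m+n (2∣2*m (2 ^ (α + length R))) eR)

  pad : Word → ℕ
  pad w = ℓ ∸ length w

  length≤ : (w : H (value R)) → length (word w) ≤ suc (length R)
  length≤ (w , l , e) = value<2^⇒length≤ l (subst (_< 2 ^ suc (length R)) (sym e) (value<2^1+length R))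

  pad+length : (w : H (value R)) → pad (word w) + length (word w) ≡ ℓ
  pad+length w = m∸n+n≡m (≤-trans (length≤ w) (s≤s (m≤n+m _ α)))

  α≤pad : (w : H (value R)) → α ≤ pad (word w)
  α≤pad w = +-cancelʳ-≤ (suc (length R)) α (pad (word w)) (begin
    α + suc (length R)            ≡⟨ +-suc α (length R) ⟩
    ℓ                             ≡⟨ sym (pad+length w) ⟩
    pad (word w) + length (word w) ≤⟨ +-monoʳ-≤ (pad (word w)) (length≤ w) ⟩
    pad (word w) + suc (length R) ∎)
    where open ≤-Reasoning

  embed : H (value R) → H M
  embed u@(w , _ , e) = padded (pad w) w , lead-one ,
    trans (value-padded (pad w) w) (trans (cong₂ _+_ (cong (2 ^_) (pad+length u)) e) (sym M≡))

  Rᴴ : H (value R)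
  Rᴴ = R , zeroFree⇒leading zR , refl

  anchor : Word
  anchor = padded (suc α) R

  embed-Rᴴ : word (embed Rᴴ) ≡ anchor
  embed-Rᴴ = cong (λ p → padded p R) (m+n∸n≡m (suc α) (length R))

  long⇒embedded : ∀ (v : H M) → suc ℓ ≤ length (word v) → ∃[ u ] word (embed u) ≡ word v
  long⇒embedded (d0 ∷ v , () , _) _
  long⇒embedded (d2 ∷ v , _ , e) (s≤s long) = ⊥-elim (<⇒≱ M<2^1+ℓ (begin
    2 ^ suc ℓ                 ≤⟨ *-monoʳ-≤ 2 (^-monoʳ-≤ 2 long) ⟩
    2 * 2 ^ length v          ≤⟨ m≤m+n _ (value v) ⟩
    2 * 2 ^ length v + value v ≡⟨ trans (sym (value-∷ d2 v)) e ⟩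
    M                         ∎))
    where open ≤-Reasoning
  long⇒embedded (d1 ∷ v , _ , e) (s≤s long) with q , w , refl , lw ← zeroRun v =
    (w , lw , value-w) , cong (λ p → padded p w) pad≡q
    where
    q+|w|≡ℓ : q + length w ≡ ℓ
    q+|w|≡ℓ = suc-injective (≤-antisym
      (≤-trans (≤-reflexive (sym (length-padded q w)))
               (value<2^⇒length≤ {padded q w} lead-one (subst (_< 2 ^ suc ℓ) (sym e) M<2^1+ℓ)))
      (s≤s (≤-trans long (≤-reflexive (suc-injective (length-padded q w))))))
    value-w : value w ≡ value R
    value-w = +-cancelˡ-≡ (2 ^ ℓ) _ _ (begin
      2 ^ ℓ + value w             ≡⟨ cong (λ l → 2 ^ l + value w) (sym q+|w|≡ℓ) ⟩
      2 ^ (q + length w) + value w ≡⟨ sym (value-padded q w) ⟩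
      value (padded q w)          ≡⟨ trans e M≡ ⟩
      2 ^ ℓ + value R             ∎)
      where open ≡-Reasoning
    pad≡q : pad w ≡ q
    pad≡q = trans (cong (_∸ length w) (sym q+|w|≡ℓ)) (m+n∸n≡m q (length w))

  lengths : ∀ u w → pad (word u) + length (word u) ≡ pad (word w) + length (word w)
  lengths u w = trans (pad+length u) (sym (pad+length w))

  root-length : suc ℓ ≡ length (word (embed Rᴴ))
  root-length = trans (cong suc (sym (pad+length Rᴴ))) (sym (length-padded (pad R) R))

  padEmbedding : ReachEmbedding (value R) M
  padEmbedding = record
    { embedding      = record
      { to        = embed
      ; injective = λ u w eq → proj₂ (zeros-++-injective _ _ (proj₁ (proj₂ u)) (proj₁ (proj₂ w)) (∷-injectiveʳ eq))
      ; arrow     = λ u w → padded-arrow⁺ _ _ (lengths u w) ,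
                            λ a → padded-arrow⁻ (proj₁ (proj₂ u)) (proj₁ (proj₂ w)) a refl refl
      ; darrow    = λ u w → padded-darrow⁺ _ _ (lengths u w) ,
                            λ a → padded-darrow⁻ (proj₁ (proj₂ u)) (proj₁ (proj₂ w)) a refl refl
      }
    ; root           = Rᴴ
    ; root-zeroFree  = zR
    ; onto-reachable = λ v (_ , p) → long⇒embedded v (≤-trans (≤-reflexive root-length) (path-length p))
    }

-- Anchors

module _ {m n} (I : Isomorphic m n) where
  open Isomorphic I

  arc-into-to : ∀ (v : H n) (u : H m) → Arc (word v) (word (to u)) → Arc (word (from v)) (word u)
  arc-into-to v u a = Embedding.arc⁻ (iso⇒embedding I) (from v) u (subst (λ s → Arc s _) (sym (to∘from v)) a)

  noIn-to : ∀ u → NoIn u → NoIn (to u)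
  noIn-to u noIn v a = noIn (from v) (arc-into-to v u a)

  uniqueIn-to : ∀ u → UniqueIn u → UniqueIn (to u)
  uniqueIn-to u (v , a , unique) = to v , Embedding.arc (iso⇒embedding I) v u a ,
    λ v′ a′ → trans (sym (to∘from v′))
                    (cong (word ∘ to) (word-injective (unique (from v′) (arc-into-to v′ u a′))))

-- The anchor of A(value (1^(α+1) 2 R)) has this property (`anchor-Anchor`), which isomorphisms
-- preserve; for even values only vertices X10 share it (`classify`).
record Anchor {n} (j : H n) : Set where
  field
    parent          : H n
    parent-arrow    : Arrow (word parent) (word j)
    parent-unique   : ∀ (v : H n) → Arc (word v) (word j) → word v ≡ word parent
    parent-in       : NoIn parent ⊎ UniqueIn parent
    below-unique    : ∀ (u : H n) → Reach (word j) (word u) → UniqueIn u → word u ≡ word j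

  uniqueIn : UniqueIn j
  uniqueIn = parent , inj₁ parent-arrow , parent-unique

anchor-to : ∀ {m n} (I : Isomorphic m n) {j} → Anchor j → Anchor (Isomorphic.to I j)
anchor-to I {j} A = record
  { parent        = to parent
  ; parent-arrow  = proj₁ (arrow parent j) parent-arrow
  ; parent-unique = proj₂ (proj₂ (uniqueIn-to I j uniqueIn))
  ; parent-in     = Data.Sum.map (noIn-to I parent) (uniqueIn-to I parent) parent-in
  ; below-unique  = λ u r uin → trans (sym (to∘from u)) (cong (word ∘ to) (word-injective
      (below-unique (from u) (iso-reach (iso-sym I) (from∘to j) r) (uniqueIn-to (iso-sym I) u uin))))
  }
  where
  open Isomorphic I
  open Anchor A

padded-run-tail : ∀ {p w} → 1 ≤ p → LeadingNonzero w → (r : SingleZeroRun (padded p w)) → w ≡ SingleZeroRun.Y r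
padded-run-tail {suc q} _ lw (run [] _ k Y split _ zY) =
  proj₂ (zeros-++-injective (suc q) (suc k) lw (zeroFree⇒leading zY) (∷-injectiveʳ split))
padded-run-tail {suc q} _ _ (run (_ ∷ []) nc _ _ split _ _) =
  ⊥-elim (nonzero⇒≢d0 nc (sym (∷-injectiveˡ (∷-injectiveʳ split))))
padded-run-tail {suc q} _ _ (run (_ ∷ _ ∷ _) _ _ _ split (_ ∷ nx ∷ _) _) =
  ⊥-elim (nonzero⇒≢d0 nx (sym (∷-injectiveˡ (∷-injectiveʳ split))))

module PaddingAnchor (α : ℕ) {R} (zR : ZeroFree R) where
  open Padding (suc α) zR
  open ReachEmbedding padEmbedding using (onto-reachable)

  anchorᴴ : H M
  anchorᴴ = embed Rᴴ

  parentᴴ : H M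
  parentᴴ = d2 ∷ zeros (suc α) ++ R , lead-two ,
    trans (arc-value (inj₁ (arr-head (zeros (suc α) ++ R)))) (trans (cong value (sym embed-Rᴴ)) (proj₂ (proj₂ anchorᴴ)))

  below-unique : ∀ (u : H M) → Reach (word anchorᴴ) (word u) → UniqueIn u → word u ≡ word anchorᴴ
  below-unique u r uin with w , eq ← onto-reachable u r = begin
    word u             ≡⟨ sym eq ⟩
    word (embed w)     ≡⟨ cong (word ∘ embed) (word-injective {u = w} {v = Rᴴ} w≡R) ⟩
    word anchorᴴ       ∎
    where
    open ≡-Reasoning
    run-w : SingleZeroRun (padded (pad (word w)) (word w))
    run-w = subst SingleZeroRun (sym eq) (uniqueIn⇒singleRun u uin)
    w≡Y : word w ≡ SingleZeroRun.Y run-w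
    w≡Y = padded-run-tail (≤-trans (s≤s z≤n) (α≤pad w)) (proj₁ (proj₂ w)) run-w
    w≡R : word w ≡ R
    w≡R = zeroFree-injective (subst ZeroFree (sym w≡Y) (SingleZeroRun.Y-zeroFree run-w)) zR (proj₂ (proj₂ w))

  anchor-Anchor : Anchor anchorᴴ
  anchor-Anchor = record
    { parent        = parentᴴ
    ; parent-arrow  = subst (Arrow _) (sym embed-Rᴴ) (arr-head (zeros (suc α) ++ R))
    ; parent-unique = λ v a →
        SingleZeroRunProperties.source-unique (run [] nz1 (suc α) R embed-Rᴴ [] zR) a (proj₁ (proj₂ v))
    ; parent-in     = inj₂ (singleRun⇒uniqueIn parentᴴ (run [] nz2 α R refl [] zR))
    ; below-unique  = below-unique
    }

darr-chain : ∀ P c S → Path c (P ++ ones c ++ d2 ∷ S) (P ++ d2 ∷ zeros c ++ S)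
darr-chain P zero    S = ε
darr-chain P (suc c) S =
  subst₂ (Path c) (++-assoc P (d1 ∷ []) _) (++-assoc P (d1 ∷ []) _) (darr-chain (P ∷ʳ d1) c S)
    ▻ inj₂ (darr P (zeros c ++ S))

zeroFree-ones⊎two : ∀ {w} → ZeroFree w →
                    (∃[ k ] w ≡ ones k) ⊎ (∃[ c ] ∃[ Y ] w ≡ ones c ++ d2 ∷ Y × ZeroFree Y)
zeroFree-ones⊎two []          = inj₁ (0 , refl)
zeroFree-ones⊎two (nz2 ∷ zw) = inj₂ (0 , _ , refl , zw)
zeroFree-ones⊎two (nz1 ∷ zw) with zeroFree-ones⊎two zw
... | inj₁ (k , refl)            = inj₁ (suc k , refl)
... | inj₂ (c , Y , refl , zY) = inj₂ (suc c , Y , refl , zY)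

ones-odd : ∀ k → ¬ 2 ∣ value (ones (suc k))
ones-odd k 2∣ with ∣1⇒≡1 (∣m+n∣m⇒∣n (subst (2 ∣_) (sym (value-ones+1 (suc k))) (2∣2*m (2 ^ k))) 2∣)
... | ()

even-zeroFree : ∀ {w} → ZeroFree w → 2 ∣ value w →
                w ≡ [] ⊎ ∃[ c ] ∃[ Y ] w ≡ ones c ++ d2 ∷ Y × ZeroFree Y × 2 ∣ value Y
even-zeroFree zw 2∣ with zeroFree-ones⊎two zw
... | inj₁ (zero , refl)  = inj₁ refl
... | inj₁ (suc k , refl) = ⊥-elim (ones-odd k 2∣)
... | inj₂ (c , Y , refl , zY) =
  inj₂ (c , Y , refl , zY , ∣m+n∣m⇒∣n (subst (2 ∣_) (value-ones-2-++ c Y) 2∣) (2∣2*m (2 ^ (c + length Y))))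

d1≢d0 : d1 ≢ d0
d1≢d0 ()

even-suffix : ∀ u y Y → 2 ∣ value (u ++ y ∷ Y) → 2 ∣ value (y ∷ Y)
even-suffix u y Y 2∣ =
  ∣m+n∣m⇒∣n (subst (2 ∣_) (value-++ u (y ∷ Y)) 2∣) (∣n⇒∣m*n (value u) (2∣2*m (2 ^ length Y)))

last-split : ∀ (x : Digit) X → ∃[ X′ ] ∃[ l ] x ∷ X ≡ X′ ∷ʳ l
last-split x []      = [] , x , refl
last-split x (y ∷ X) with X′ , l , eq ← last-split y X = x ∷ X′ , l , cong (x ∷_) eq

AnchorShape : Word → Word → Set
AnchorShape anchor w = w ≡ anchor ⊎ ∃[ X ] ZeroFree X × w ≡ X ++ d1 ∷ d0 ∷ []

module Classification (α : ℕ) {R} (zR : ZeroFree R) where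
  open Padding α zR using (M; ℓ; M≡; R<2^ℓ; anchor)

  front-is-anchor : ∀ {k Y} → ZeroFree Y → value (padded (suc k) Y) ≡ M → padded (suc k) Y ≡ anchor
  front-is-anchor {k} {Y} zY e = cong₂ padded k≡α Y≡R
    where
    Y<2^ : value Y < 2 ^ (suc k + length Y)
    Y<2^ = <-≤-trans (value<2^1+length Y) (^-monoʳ-≤ 2 (s≤s (m≤n+m _ k)))
    top : 2 ^ (suc k + length Y) + value Y ≡ 2 ^ ℓ + value R
    top = trans (sym (value-padded (suc k) Y)) (trans e M≡)
    exps : suc k + length Y ≡ ℓ
    exps = 2^m+x≡2^n+y⇒m≡n Y<2^ R<2^ℓ top
    Y≡R : Y ≡ R
    Y≡R = zeroFree-injective zY zR (+-cancelˡ-≡ (2 ^ ℓ) _ _ (trans (cong (λ l → 2 ^ l + value Y) (sym exps)) top))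
    k≡α : suc k ≡ suc α
    k≡α = +-cancelʳ-≡ (length R) _ _ (trans (cong (λ Y → suc k + length Y) (sym Y≡R)) exps)

  module _ (2∣M : 2 ∣ M) {j : H M} (A : Anchor j) where
    open Anchor A

    parent≢X020 : ∀ x X {T} → ZeroFree (x ∷ X) → word parent ≡ (x ∷ X) ++ d0 ∷ d2 ∷ d0 ∷ T → ⊥
    parent≢X020 x X {T} zX eq with X′ , l , x∷X≡ ← last-split x X =
      [ (λ noIn → zeroFree⇒¬factor (noIn⇒zeroFree parent noIn) (factor X′ nl (d2 ∷ d0 ∷ T) eq′))
      , twoRuns⇒¬uniqueIn parent X′ nl [] nz2 T eq′
      ]′ parent-in
      where
      nl : NonzeroDigit l
      nl = proj₂ (∷ʳ⁻ (subst ZeroFree x∷X≡ zX))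
      eq′ : word parent ≡ X′ ++ l ∷ d0 ∷ d2 ∷ d0 ∷ T
      eq′ = trans eq (trans (cong (_++ _) x∷X≡) (++-assoc X′ (l ∷ []) _))

    even-word : ∀ {w} → word j ≡ w → 2 ∣ value w
    even-word eq = subst (2 ∣_) (trans (sym (proj₂ (proj₂ j))) (cong value eq)) 2∣M

    -- With Y = 1^c 2 Y₃, carrying the 2 to the left leads from X10Y to X110^(c+1)Y₃, which also
    -- has a unique in-neighbour.
    ¬nonempty-tail : ∀ X y Y → ZeroFree X → ZeroFree (y ∷ Y) → word j ≡ X ++ d1 ∷ d0 ∷ y ∷ Y → ⊥
    ¬nonempty-tail X y Y zX zY eq
      with inj₂ (c , Y₃ , tail≡ , zY₃ , _) ←
             even-zeroFree zY (even-suffix (X ++ d1 ∷ d0 ∷ []) y Y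
                                           (even-word (trans eq (sym (++-assoc X (d1 ∷ d0 ∷ []) _))))) =
      d1≢d0 (∷-injectiveˡ (∷-injectiveʳ (++-cancelˡ X _ _ (begin
        X ++ d1 ∷ d1 ∷ d0 ∷ zeros c ++ Y₃   ≡⟨ sym (++-assoc X (d1 ∷ []) _) ⟩
        word t                               ≡⟨ below-unique t (suc c , j⇝t) (singleRun⇒uniqueIn t t-run) ⟩
        word j                               ≡⟨ eq ⟩
        X ++ d1 ∷ d0 ∷ y ∷ Y                 ∎))))
      where
      open ≡-Reasoning
      P : Word
      P = X ++ d1 ∷ d0 ∷ []
      tw : Word
      tw = (X ∷ʳ d1) ++ d1 ∷ zeros (suc c) ++ Y₃
      j≡ : word j ≡ P ++ ones c ++ d2 ∷ Y₃
      j≡ = trans eq (trans (cong (λ T → X ++ d1 ∷ d0 ∷ T) tail≡) (sym (++-assoc X (d1 ∷ d0 ∷ []) _)))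
      last-step : Arrow (P ++ d2 ∷ zeros c ++ Y₃) tw
      last-step = subst (λ s → Arrow s tw) (trans (++-assoc X (d1 ∷ []) _) (sym (++-assoc X (d1 ∷ d0 ∷ []) _)))
                        (arr-mid (X ∷ʳ d1) (zeros c ++ Y₃))
      j⇝t : Path (suc c) (word j) tw
      j⇝t = subst (λ s → Path (suc c) s tw) (sym j≡) (darr-chain P c Y₃ ▻ inj₁ last-step)
      t : H M
      t = tw , path-isHyperbinary j⇝t (proj₂ j)
      t-run : SingleZeroRun tw
      t-run = run (X ∷ʳ d1) nz1 c Y₃ refl (∷ʳ⁺ zX nz1) zY₃

    classify-run : (r : SingleZeroRun (word j)) → SingleZeroRun.c r ≡ d1 →
             word parent ≡ source (SingleZeroRun.runFactor r) →
             AnchorShape anchor (word j)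
    classify-run (run []      nz1 k       Y  split _  zY) refl _ =
      inj₁ (trans split (front-is-anchor zY (trans (cong value (sym split)) (proj₂ (proj₂ j)))))
    classify-run (run (x ∷ X) nz1 (suc k) Y  _     zX _)  refl parent≡ = ⊥-elim (parent≢X020 x X zX parent≡)
    classify-run (run (x ∷ X) nz1 zero    [] split zX _)  refl _ = inj₂ (x ∷ X , zX , split)
    classify-run (run X       nz1 zero (y ∷ Y) split zX zY) refl _ = ⊥-elim (¬nonempty-tail X y Y zX zY split)
    classify-run (run _       nz2 _ _ _ _ _) () _

    classify : AnchorShape anchor (word j)
    classify = classify-run r (arrow⇒c≡d1 parent-arrow) (source-unique (inj₁ parent-arrow) (proj₁ (proj₂ parent)))
      where
      r : SingleZeroRun (word j)
      r = uniqueIn⇒singleRun j uniqueIn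
      open SingleZeroRunProperties r

-- Two isomorphic even numbers

path-to-anchor : ∀ α R → Path (suc α) (ones α ++ d2 ∷ R) (padded (suc α) R)
path-to-anchor α R = darr-chain [] α R ▻ inj₁ (arr-head (zeros α ++ R))

carry-chain : ∀ P c → Path c (P ++ d0 ∷ twos c) (P ++ (ones c ∷ʳ d0))
carry-chain P zero    = ε
carry-chain P (suc c) =
  inj₁ (arr-mid P (twos c))
    ◅ subst₂ (Path c) (++-assoc P (d1 ∷ []) _) (++-assoc P (d1 ∷ []) _) (carry-chain (P ∷ʳ d1) c)

even-zeroFree-last : ∀ {R} → ZeroFree R → 2 ∣ value R → R ≡ [] ⊎ ∃[ R′ ] R ≡ R′ ∷ʳ d2
even-zeroFree-last {R} zR 2∣ with initLast R
... | []      = inj₁ refl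
... | R′ ∷ʳ′ e with proj₂ (∷ʳ⁻ zR)
...   | nz1 = ⊥-elim (2∤2*m+1 (value R′) (subst (2 ∣_) (value-∷ʳ R′ d1) 2∣))
...   | nz2 = inj₂ (R′ , refl)

value-++-ones : ∀ R t → value (R ++ ones t) ≡ appendOnes t (value R)
value-++-ones R t = appendOnes-unique t (value R) (begin
  value (R ++ ones t) + 1                                ≡⟨ cong (_+ 1) (value-++ R (ones t)) ⟩
  value R * 2 ^ length (ones t) + value (ones t) + 1     ≡⟨ +-assoc (value R * 2 ^ length (ones t)) _ 1 ⟩
  value R * 2 ^ length (ones t) + (value (ones t) + 1)
    ≡⟨ cong₂ (λ l v → value R * 2 ^ l + v) (length-replicate t) (value-ones+1 t) ⟩
  value R * 2 ^ t + 2 ^ t                                ≡⟨ +-comm (value R * 2 ^ t) (2 ^ t) ⟩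
  2 ^ t + value R * 2 ^ t                                ≡⟨ cong (2 ^ t +_) (*-comm (value R) (2 ^ t)) ⟩
  2 ^ t + 2 ^ t * value R                                ≡⟨ sym (*-suc (2 ^ t) (value R)) ⟩
  2 ^ t * suc (value R)                                  ∎)
  where open ≡-Reasoning

zeroFree-arrow : ∀ {s t} → ZeroFree s → Arrow s t → ∃[ y ] s ≡ d2 ∷ y × t ≡ d1 ∷ d0 ∷ y
zeroFree-arrow zs (arr-mid x y) with ++⁻ʳ x zs
... | () ∷ _
zeroFree-arrow zs (arr-head y) = y , refl , refl

∷ʳ≢[] : ∀ X {d : Digit} → X ∷ʳ d ≢ []
∷ʳ≢[] []      ()
∷ʳ≢[] (_ ∷ _) ()

ones-2-≡-2∷ : ∀ β {S y} → ones β ++ d2 ∷ S ≡ d2 ∷ y → β ≡ 0 × y ≡ S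
ones-2-≡-2∷ zero    eq = refl , sym (∷-injectiveʳ eq)
ones-2-≡-2∷ (suc β) ()

RelatedBelow : ℕ → Set
RelatedBelow s = ∀ x y → x + y < s → Isomorphic x y → Related x y

module EvenPair (α β : ℕ) {R S} (zR : ZeroFree R) (zS : ZeroFree S) (eR : 2 ∣ value R) (eS : 2 ∣ value S)
                (I : Isomorphic (value (ones α ++ d2 ∷ R)) (value (ones β ++ d2 ∷ S)))
                (IH : RelatedBelow (value (ones α ++ d2 ∷ R) + value (ones β ++ d2 ∷ S))) where
  module PM = Padding α zR
  module PN = Padding β zS
  open Isomorphic I

  sM sN : Word
  sM = ones α ++ d2 ∷ R
  sN = ones β ++ d2 ∷ S

  zsM : ZeroFree sM
  zsM = ++⁺ (replicate⁺ α nz1) (nz2 ∷ zR)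

  zsN : ZeroFree sN
  zsN = ++⁺ (replicate⁺ β nz1) (nz2 ∷ zS)

  sMᴴ : H PM.M
  sMᴴ = sM , zeroFree⇒leading zsM , refl

  anchorMᴴ : H PM.M
  anchorMᴴ = PM.embed PM.Rᴴ

  anchorNᴴ : H PN.M
  anchorNᴴ = PN.embed PN.Rᴴ

  source-to : word (to sMᴴ) ≡ sN
  source-to = zeroFree-injective (noIn⇒zeroFree (to sMᴴ) (noIn-to I sMᴴ (zeroFree⇒noIn sMᴴ zsM)))
                                 zsN (proj₂ (proj₂ (to sMᴴ)))

  sN⇝to-anchorM : Path (suc α) sN (word (to anchorMᴴ))
  sN⇝to-anchorM = subst (λ s → Path (suc α) s (word (to anchorMᴴ))) source-to
    (Embedding.path (iso⇒embedding I) sMᴴ anchorMᴴ (subst (Path (suc α) sM) (sym PM.embed-Rᴴ) (path-to-anchor α R)))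

  straight : word (to anchorMᴴ) ≡ word anchorNᴴ → sM ≡ sN
  straight e = cong₂ (λ k T → ones k ++ d2 ∷ T) α≡β R≡S
    where
    α≡β : α ≡ β
    α≡β = suc-injective
      (path-lengths-equal (subst (Path (suc α) sN) (trans e PN.embed-Rᴴ) sN⇝to-anchorM) (path-to-anchor β S))
    R≡S : R ≡ S
    R≡S = zeroFree-injective zR zS (related-even eR eS
      (IH _ _ (+-mono-< PM.R<M PN.R<M) (restrict PM.padEmbedding PN.padEmbedding I e)))

  head-arrow : Arrow sM (word anchorMᴴ) → β ≡ 0 × word (to anchorMᴴ) ≡ word anchorNᴴ
  head-arrow a
    with y , sN≡ , to-anchor≡ ← zeroFree-arrow zsN (subst (λ s → Arrow s _) source-to (proj₁ (arrow sMᴴ anchorMᴴ) a))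
    with β≡0 , y≡S ← ones-2-≡-2∷ β sN≡ =
    β≡0 , trans to-anchor≡ (trans (cong (λ T → d1 ∷ d0 ∷ T) y≡S)
                                  (sym (trans PN.embed-Rᴴ (cong (λ b → padded (suc b) S) β≡0))))

  module Crossed {X} (zX : ZeroFree X) (eX : word (to anchorMᴴ) ≡ X ++ d1 ∷ d0 ∷ []) where
    W : Word
    W = X ∷ʳ d1

    zW : ZeroFree W
    zW = ∷ʳ⁺ zX nz1

    W0≡ : W ∷ʳ d0 ≡ word (to anchorMᴴ)
    W0≡ = trans (++-assoc X (d1 ∷ []) (d0 ∷ [])) (sym eX)

    N≡ : value (W ∷ʳ d0) ≡ PN.M
    N≡ = trans (cong value W0≡) (proj₂ (proj₂ (to anchorMᴴ)))

    0<W : 0 < value W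
    0<W = value-∷ʳ-positive {X} nz1

    W<N : value W < PN.M
    W<N = <-≤-trans (m<m+n (value W) 0<W)
                    (≤-reflexive (trans (double (value W)) (trans (sym (value-∷ʳ W d0)) N≡)))
      where
      double : ∀ w → w + w ≡ 2 * w + 0
      double = solve-∀

    W-odd : ¬ 2 ∣ value W
    W-odd 2∣ = 2∤2*m+1 (value X) (subst (2 ∣_) (value-∷ʳ X d1) 2∣)

    appended : ∃[ t ] value W ≡ appendOnes t (value R)
    appended = related-even-odd eR W-odd (IH _ _ (+-mono-< PM.R<M W<N)
      (restrict PM.padEmbedding (snocEmbedding zW (λ ()) (inj₁ 0<W) N≡) I (sym W0≡)))

    t : ℕ
    t = proj₁ appended

    W≡ : W ≡ R ++ ones t
    W≡ = zeroFree-injective zW (++⁺ zR (replicate⁺ t nz1)) (trans (proj₂ appended) (sym (value-++-ones R t)))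

    sN≡ : ∀ {k Z} → ZeroFree Z → Path k Z (W ∷ʳ d0) → sN ≡ Z
    sN≡ zZ p = zeroFree-injective zsN zZ (trans (sym N≡) (sym (path-value p)))

    sN⇝W0 : Path (suc α) sN (W ∷ʳ d0)
    sN⇝W0 = subst (Path (suc α) sN) (sym W0≡) sN⇝to-anchorM

  -- A(value R) ≅ A(value X1) by restriction, so X1 = R 1^t by induction; then the zero-free word
  -- R′ 1 2^(t+1) reaches X10 in t + 1 steps, and the source of A(N) reaches it in α + 1 steps.
  crossed-half : 0 < β → ∀ {X} → ZeroFree X → word (to anchorMᴴ) ≡ X ++ d1 ∷ d0 ∷ [] →
                 ∃[ R′ ] R ≡ R′ ∷ʳ d2 × sN ≡ R′ ++ d1 ∷ twos (suc α)
  crossed-half 0<β {X} zX eX with even-zeroFree-last zR eR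
  ... | inj₁ R≡[] = ⊥-elim (W≢ones t (trans W≡ (cong (_++ ones t) R≡[])))
    where
    open Crossed zX eX
    W≢ones : ∀ k → W ≢ ones k
    W≢ones zero    W≡[] = ∷ʳ≢[] X W≡[]
    W≢ones (suc k) W≡1ᵏ = <⇒≢ 0<β (sym (proj₁ (ones-2-≡-2∷ β (sN≡ (replicate⁺ (suc k) nz2) twos⇝W0))))
      where
      twos⇝W0 : Path (suc k) (twos (suc k)) (W ∷ʳ d0)
      twos⇝W0 = subst (Path (suc k) _) (cong (_∷ʳ d0) (sym W≡1ᵏ))
                      (inj₁ (arr-head (twos k)) ◅ carry-chain (d1 ∷ []) k)
  ... | inj₂ (R′ , R≡) = R′ , R≡ , trans (sN≡ zZ Z⇝W0) (cong (λ k → R′ ++ d1 ∷ twos (suc k)) t≡α)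
    where
    open Crossed zX eX
    Z : Word
    Z = R′ ++ d1 ∷ twos (suc t)
    zZ : ZeroFree Z
    zZ = ++⁺ (proj₁ (∷ʳ⁻ (subst ZeroFree R≡ zR))) (nz1 ∷ replicate⁺ (suc t) nz2)
    Z⇝W0 : Path (suc t) Z (W ∷ʳ d0)
    Z⇝W0 = inj₂ (darr R′ (twos t)) ◅ subst₂ (Path t) (++-assoc R′ (d2 ∷ []) _) carried (carry-chain (R′ ∷ʳ d2) t)
      where
      carried : (R′ ∷ʳ d2) ++ (ones t ∷ʳ d0) ≡ W ∷ʳ d0
      carried = trans (++-∷ʳ (R′ ∷ʳ d2) (ones t) d0) (cong (_∷ʳ d0) (trans (cong (_++ ones t) (sym R≡)) (sym W≡)))
    t≡α : t ≡ α
    t≡α = suc-injective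
      (path-lengths-equal (subst (λ s → Path (suc t) s (W ∷ʳ d0)) (sym (sN≡ zZ Z⇝W0)) Z⇝W0) sN⇝W0)

digitSum-ones : ∀ k → digitSum (ones k) ≡ k
digitSum-ones zero    = refl
digitSum-ones (suc k) = cong suc (digitSum-ones k)

digitSum-twos : ∀ k → digitSum (twos k) ≡ 2 * k
digitSum-twos zero    = refl
digitSum-twos (suc k) = trans (cong (2 +_) (digitSum-twos k)) (sym (*-suc 2 k))

digitSum-ones-2-∷ʳ : ∀ k T → digitSum (ones k ++ d2 ∷ (T ∷ʳ d2)) ≡ k + (2 + (digitSum T + 2))
digitSum-ones-2-∷ʳ k T = trans (digitSum-++ (ones k) _)
  (cong₂ (λ a b → a + (2 + b)) (digitSum-ones k) (digitSum-++ T (d2 ∷ [])))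

digitSum-1-twos : ∀ T k → digitSum (T ++ d1 ∷ twos k) ≡ digitSum T + (1 + 2 * k)
digitSum-1-twos T k = trans (digitSum-++ T _) (cong (λ b → digitSum T + (1 + b)) (digitSum-twos k))

12-commute : ∀ A → d1 ∷ d2 ∷ d1 ∷ d2 ∷ A ≡ A ++ d1 ∷ d2 ∷ d1 ∷ d2 ∷ [] →
             d1 ∷ d2 ∷ A ≡ A ++ d1 ∷ d2 ∷ []
12-commute []          _ = refl
12-commute (_ ∷ [])    ()
12-commute (_ ∷ _ ∷ A) e with refl , e′ ← ∷-injective e with refl , e″ ← ∷-injective e′ =
  cong (λ T → d1 ∷ d2 ∷ T) (12-commute A e″)

12-swap : ∀ A B → d1 ∷ d2 ∷ A ≡ B ++ d1 ∷ d2 ∷ [] → d1 ∷ d2 ∷ B ≡ A ++ d1 ∷ d2 ∷ [] → A ≡ B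
12-swap []          B e₁ e₂ = sym (∷-injectiveʳ (∷-injectiveʳ e₂))
12-swap (_ ∷ [])    B e₁ ()
12-swap (_ ∷ _ ∷ A) B e₁ e₂ with refl , e₂′ ← ∷-injective e₂ with refl , B≡ ← ∷-injective e₂′ =
  trans (12-commute A (trans e₁ (trans (cong (_++ d1 ∷ d2 ∷ []) B≡) (++-assoc A (d1 ∷ d2 ∷ []) _)))) (sym B≡)

no-extra-ones : ∀ a b r s → suc a + (2 + (r + 2)) ≡ s + (1 + 2 * suc (suc b)) →
                suc b + (2 + (s + 2)) ≡ r + (1 + 2 * suc (suc a)) → a + b ≡ 0
no-extra-ones a b r s x y = sym (+-cancelˡ-≡ (a + b + r + s + 10) _ _
  (trans (lhs a b r s) (trans (cong₂ _+_ x y) (rhs a b r s))))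
  where
  lhs : ∀ a b r s → a + b + r + s + 10 + 0 ≡ suc a + (2 + (r + 2)) + (suc b + (2 + (s + 2)))
  lhs = solve-∀
  rhs : ∀ a b r s → s + (1 + 2 * suc (suc b)) + (r + (1 + 2 * suc (suc a))) ≡ a + b + r + s + 10 + (a + b)
  rhs = solve-∀

drop-last-2 : ∀ A B → d1 ∷ d2 ∷ (A ∷ʳ d2) ≡ B ++ d1 ∷ d2 ∷ d2 ∷ [] → d1 ∷ d2 ∷ A ≡ B ++ d1 ∷ d2 ∷ []
drop-last-2 A B e = proj₁ (∷ʳ-injective (d1 ∷ d2 ∷ A) (B ++ d1 ∷ d2 ∷ []) (trans e (++-∷ʳ B (d1 ∷ d2 ∷ []) d2)))

Crossing : Word → Word → ℕ → ℕ → Set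
Crossing R′ S′ α β = ones (suc α) ++ d2 ∷ (R′ ∷ʳ d2) ≡ S′ ++ d1 ∷ twos (suc (suc β))

crossing-ones : ∀ α β {R′ S′} → Crossing R′ S′ α β → Crossing S′ R′ β α → α + β ≡ 0
crossing-ones α β {R′} {S′} e₁ e₂ = no-extra-ones α β (digitSum R′) (digitSum S′)
  (trans (sym (digitSum-ones-2-∷ʳ (suc α) R′)) (trans (cong digitSum e₁) (digitSum-1-twos S′ _)))
  (trans (sym (digitSum-ones-2-∷ʳ (suc β) S′)) (trans (cong digitSum e₂) (digitSum-1-twos R′ _)))

-- Digit sums force α = β = 0, and then 12R′ = S′12 and 12S′ = R′12.
crossed-words : ∀ α β {R S R′ S′} → R ≡ R′ ∷ʳ d2 → S ≡ S′ ∷ʳ d2 →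
                ones (suc α) ++ d2 ∷ R ≡ S′ ++ d1 ∷ twos (suc (suc β)) →
                ones (suc β) ++ d2 ∷ S ≡ R′ ++ d1 ∷ twos (suc (suc α)) →
                ones (suc α) ++ d2 ∷ R ≡ ones (suc β) ++ d2 ∷ S
crossed-words zero    zero    {R′ = R′} {S′} refl refl e₁ e₂ =
  cong (λ T → d1 ∷ d2 ∷ (T ∷ʳ d2)) (12-swap R′ S′ (drop-last-2 R′ S′ e₁) (drop-last-2 S′ R′ e₂))
crossed-words (suc α) β       refl refl e₁ e₂ = ⊥-elim (1+n≢0 (crossing-ones (suc α) β e₁ e₂))
crossed-words zero    (suc β) refl refl e₁ e₂ = ⊥-elim (1+n≢0 (crossing-ones zero (suc β) e₁ e₂))

RelatedBelow-comm : ∀ m n → RelatedBelow (m + n) → RelatedBelow (n + m)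
RelatedBelow-comm m n = subst RelatedBelow (+-comm m n)

padded≢X10 : ∀ q {w X} → ZeroFree X → padded (suc (suc q)) w ≢ X ++ d1 ∷ d0 ∷ []
padded≢X10 q []           ()
padded≢X10 q (_ ∷ [])     ()
padded≢X10 q (_ ∷ nx ∷ _) eq = nonzero⇒≢d0 nx (sym (∷-injectiveˡ (∷-injectiveʳ eq)))

even-expansions-equal : ∀ α β {R S} (zR : ZeroFree R) (zS : ZeroFree S) → 2 ∣ value R → 2 ∣ value S →
            Isomorphic (value (ones α ++ d2 ∷ R)) (value (ones β ++ d2 ∷ S)) →
            RelatedBelow (value (ones α ++ d2 ∷ R) + value (ones β ++ d2 ∷ S)) →
            ones α ++ d2 ∷ R ≡ ones β ++ d2 ∷ S
even-expansions-equal zero β {R} zR zS eR eS I IH =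
  straight (proj₂ (head-arrow (subst (Arrow (d2 ∷ R)) (sym PM.embed-Rᴴ) (arr-head R))))
  where open EvenPair zero β zR zS eR eS I IH
even-expansions-equal (suc α) zero {S = S} zR zS eR eS I IH =
  ⊥-elim (1+n≢0 (proj₁ (head-arrow (subst (Arrow (d2 ∷ S)) (sym PM.embed-Rᴴ) (arr-head S)))))
  where open EvenPair zero (suc α) zS zR eS eR (iso-sym I) (RelatedBelow-comm _ (value (d2 ∷ S)) IH)
even-expansions-equal (suc α) (suc β) {R} {S} zR zS eR eS I IH = conclude image-of-anchorM image-of-anchorN
  where
  module Fwd = EvenPair (suc α) (suc β) zR zS eR eS I IH
  module Bwd = EvenPair (suc β) (suc α) zS zR eS eR (iso-sym I) (RelatedBelow-comm _ (value (ones (suc β) ++ d2 ∷ S)) IH)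
  open Isomorphic I

  image-of-anchorM : AnchorShape (Padding.anchor (suc β) zS) (word (to Fwd.anchorMᴴ))
  image-of-anchorM = Classification.classify (suc β) zS (Padding.even-M (suc β) zS eS)
                                             (anchor-to I (PaddingAnchor.anchor-Anchor α zR))
  image-of-anchorN : AnchorShape (Padding.anchor (suc α) zR) (word (from Fwd.anchorNᴴ))
  image-of-anchorN = Classification.classify (suc α) zR (Padding.even-M (suc α) zR eR)
                                             (anchor-to (iso-sym I) (PaddingAnchor.anchor-Anchor β zS))

  conclude : AnchorShape (Padding.anchor (suc β) zS) (word (to Fwd.anchorMᴴ)) →
             AnchorShape (Padding.anchor (suc α) zR) (word (from Fwd.anchorNᴴ)) →
             ones (suc α) ++ d2 ∷ R ≡ ones (suc β) ++ d2 ∷ S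
  conclude (inj₁ e) _ = Fwd.straight (trans e (sym Fwd.PN.embed-Rᴴ))
  conclude (inj₂ (X , zX , eX)) (inj₁ e) = ⊥-elim (padded≢X10 β zX (begin
    padded (suc (suc β)) S      ≡⟨ sym Fwd.PN.embed-Rᴴ ⟩
    word Fwd.anchorNᴴ           ≡⟨ sym (to∘from Fwd.anchorNᴴ) ⟩
    word (to (from Fwd.anchorNᴴ)) ≡⟨ cong (word ∘ to) (word-injective (trans e (sym Fwd.PM.embed-Rᴴ))) ⟩
    word (to Fwd.anchorMᴴ)      ≡⟨ eX ⟩
    X ++ d1 ∷ d0 ∷ []           ∎))
    where open ≡-Reasoning
  conclude (inj₂ (X , zX , eX)) (inj₂ (Y , zY , eY))
    with R′ , R≡ , sN≡ ← Fwd.crossed-half (s≤s z≤n) zX eX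
    with S′ , S≡ , sM≡ ← Bwd.crossed-half (s≤s z≤n) zY eY = crossed-words α β R≡ S≡ sM≡ sN≡

related-refl : ∀ n → Related n n
related-refl n = 0 , inj₁ (sym (appendOnes-zero n))

even-expansion-form : ∀ {m} → 2 ∣ m → 0 < m →
                ∃[ α ] ∃[ R ] ZeroFree R × 2 ∣ value R × value (ones α ++ d2 ∷ R) ≡ m
even-expansion-form {m} 2∣m 0<m with w , zw , refl ← zeroFree-expansion m with even-zeroFree zw 2∣m
... | inj₁ refl                     = ⊥-elim (<-irrefl refl 0<m)
... | inj₂ (α , R , refl , zR , eR) = α , R , zR , eR , refl

no-arcs-0 : ∀ (u v : H 0) → ¬ Arc (word u) (word v)
no-arcs-0 (u , _ , e) _ a = n≮0 (subst₂ _≤_ (arc-digitSum a) e (digitSum≤value u))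

¬iso-0-even : ∀ {n} → 2 ∣ n → 0 < n → ¬ Isomorphic 0 n
¬iso-0-even 2∣n 0<n I with α , R , zR , _ , refl ← even-expansion-form 2∣n 0<n with path-to-anchor α R
... | a ◅ _ = no-arcs-0 (from u) (from v) (Embedding.arc (iso⇒embedding (iso-sym I)) u v a)
  where
  open Isomorphic I
  u v : H (value (ones α ++ d2 ∷ R))
  u = ones α ++ d2 ∷ R , zeroFree⇒leading (++⁺ (replicate⁺ α nz1) (nz2 ∷ zR)) , refl
  v = _ , arc-isHyperbinary a (proj₂ u)

even-equal : ∀ {m n} → 2 ∣ m → 2 ∣ n → 0 < m → 0 < n → RelatedBelow (m + n) → Isomorphic m n → m ≡ n
even-equal 2∣m 2∣n 0<m 0<n IH I
  with α , R , zR , eR , refl ← even-expansion-form 2∣m 0<m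
  with β , S , zS , eS , refl ← even-expansion-form 2∣n 0<n = cong value (even-expansions-equal α β zR zS eR eS I IH)

k<2k+1 : ∀ k → k < 2 * k + 1
k<2k+1 k = ≤-trans (s≤s (m≤m+n k (k + 0))) (≤-reflexive (+-comm 1 (2 * k)))

isomorphic⇒related-below : ∀ m n → RelatedBelow (m + n) → Isomorphic m n → Related m n
isomorphic⇒related-below m n IH I with parity m | parity n
... | k , inj₂ refl | _ = related-2*m+1 (IH k n (+-monoˡ-< n (k<2k+1 k)) (iso-trans (iso-2*n+1 k) I))
... | _ | k , inj₂ refl = related-sym (related-2*m+1 (IH k m (subst (k + m <_) (+-comm _ m) (+-monoˡ-< m (k<2k+1 k)))
                                                          (iso-trans (iso-2*n+1 k) (iso-sym I))))
... | zero  , inj₁ refl | zero  , inj₁ refl = related-refl 0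
... | zero  , inj₁ refl | suc b , inj₁ refl = ⊥-elim (¬iso-0-even (2∣2*m (suc b)) (s≤s z≤n) I)
... | suc a , inj₁ refl | zero  , inj₁ refl = ⊥-elim (¬iso-0-even (2∣2*m (suc a)) (s≤s z≤n) (iso-sym I))
... | suc a , inj₁ refl | suc b , inj₁ refl =
  subst (Related _) (even-equal (2∣2*m (suc a)) (2∣2*m (suc b)) (s≤s z≤n) (s≤s z≤n) IH I) (related-refl _)

isomorphic⇒related : ∀ m n → Isomorphic m n → Related m n
isomorphic⇒related m n = <-rec Goal step (m + n) m n refl
  where
  Goal : ℕ → Set
  Goal s = ∀ m n → m + n ≡ s → Isomorphic m n → Related m n
  step : ∀ s → (∀ {s′} → s′ < s → Goal s′) → Goal s
  step _ rec m n refl = isomorphic⇒related-below m n (λ x y lt → rec lt x y refl)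

mainTheorem5 : (m n : ℕ) →
    Isomorphic m n ⇔' (∃ λ (t : ℕ) → (m ≡ (2 ^ t * n + 2 ^ t) ∸ 1) ⊎ (n ≡ (2 ^ t * m + 2 ^ t) ∸ 1))
mainTheorem5 m n = isomorphic⇒related m n , related⇒isomorphic
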